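{- Let $G$ be an innocent cobipartite graph $(A,B)$ and let $Z$ be a consistent set of safe vertices in $G$. Then $G$ has a strong stable set that contains $Z$.
   Context: Graphs are finite and simple. A cobipartite graph $(A,B)$ is a graph whose vertex set is partitioned into two cliques $A,B$. Stable set: pairwise non-adjacent; strong: meets every maximal clique. A path is a sequence of distinct vertices $p_0\hbox{ - }\dots\hbox{ - }p_k$ with $p_i$ adjacent to $p_j$ iff $|i-j|=1$; length $k$. Hole of length $k\ge4$: induced $C_k$; antihole: induced complement of $C_k$. Prism: two vertex-disjoint triangles $\{a_1,a_2,a_3\},\{b_1,b_2,b_3\}$ and paths $P_i$ with ends $a_i,b_i$, for $i<j$ only edges between $V(P_i),V(P_j)$ being $a_ia_j,b_ib_j$; odd if all $P_i$ odd. Handcuff: two vertex-disjoint even holes $C_1,C_2$ and a disjoint odd-length path $p_1\hbox{ - }\dots\hbox{ - }p_r$, $p_1$ with exactly two neighbours in $V(C_1)$, adjacent, $p_r$ with exactly two in $V(C_2)$, adjacent, no other edges among the parts. Eye mask: two vertex-disjoint even holes $C_1,C_2$, edges $x_1y_1\in E(C_1),x_2y_2\in E(C_2)$ with $\{x_1,y_1\}$ complete to $\{x_2,y_2\}$, no other edges between $V(C_1),V(C_2)$. Innocent: no odd hole, no antihole of length $\ge6$, no odd prism, handcuff or eye mask. Simplicial vertex: neighbourhood is a clique. Clown: graph on $\{c_0,\dots,c_k\}$, $c_1\hbox{ - }\dots\hbox{ - }c_k\hbox{ - }c_1$ an even hole, $c_0$ (the hat $h(D)$) adjacent to exactly $c_1,c_2$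 among $c_1,\dots,c_k$. A vertex $v$ is safe if simplicial and for every clown $D$ in the graph every path with ends $v,h(D)$ whose vertices other than $h(D)$ are disjoint from and anticomplete to $V(D)\setminus\{h(D)\}$ has odd length. Even pair: every path between the two vertices has even length; consistent: every two members form an even pair. -}

module Defs where

open import Data.Nat using (ℕ; zero; suc; _≤_)
open import Data.Nat.Divisibility using (_∣_)
open import Data.Fin using (Fin; zero; suc; toℕ; fromℕ)
open import Data.Fin.Subset using (Subset; _∈_; _∉_; _⊆_; ∁)
open import Data.Bool using (Bool; T)
open import Data.Product using (Σ; ∃; ∃-syntax; _×_; _,_)
open import Data.Sum using (_⊎_)
open import Relation.Nullary using (¬_)
open import Relation.Binary.PropositionalEquality using (_≡_; _≢_)
open import Function.Bundles using (_⇔_)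
open import Function.Definitions using (Injective)

record Graph : Set where
  field
    n      : ℕ
    adj    : Fin n → Fin n → Bool
    sym    : ∀ u v → T (adj u v) → T (adj v u)
    irrefl : ∀ v → ¬ T (adj v v)

Even : ℕ → Set
Even k = 2 ∣ k

Odd : ℕ → Set
Odd k = ¬ (2 ∣ k)

CycNext : (k : ℕ) → Fin k → Fin k → Set
CycNext k i j = (suc (toℕ i) ≡ toℕ j) ⊎ ((suc (toℕ i) ≡ k) × (toℕ j ≡ 0))

CycAdj : (k : ℕ) → Fin k → Fin k → Set
CycAdj k i j = CycNext k i j ⊎ CycNext k j i

module _ (G : Graph) where
  open Graph G

  V : Set
  V = Fin n

  Adj : V → V → Set
  Adj u v = T (adj u v)

  IsClique : Subset n → Set
  IsClique K = ∀ u v → u ∈ K → v ∈ K → u ≢ v → Adj u v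

  IsMaximalClique : Subset n → Set
  IsMaximalClique K =
    IsClique K × (∃[ v ] v ∈ K) ×
    (∀ K′ → IsClique K′ → K ⊆ K′ → K′ ⊆ K)

  IsStable : Subset n → Set
  IsStable S = ∀ u v → u ∈ S → v ∈ S → ¬ Adj u v

  IsStrongStable : Subset n → Set
  IsStrongStable S =
    IsStable S × (∀ K → IsMaximalClique K → ∃[ v ] (v ∈ K × v ∈ S))

  IsCobipartite : Subset n → Set
  IsCobipartite A = IsClique A × IsClique (∁ A)

  record Path : Set where
    field
      len    : ℕ
      vtx    : Fin (suc len) → V
      inj    : Injective _≡_ _≡_ vtx
      adjIff : ∀ i j →
        Adj (vtx i) (vtx j) ⇔ ((suc (toℕ i) ≡ toℕ j) ⊎ (suc (toℕ j) ≡ toℕ i))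

    start : V
    start = vtx zero

    end : V
    end = vtx (fromℕ len)

  _∈P_ : V → Path → Set
  x ∈P P = ∃[ i ] Path.vtx P i ≡ x

  record Hole : Set where
    field
      len    : ℕ
      len≥4  : 4 ≤ len
      vtx    : Fin len → V
      inj    : Injective _≡_ _≡_ vtx
      adjIff : ∀ i j → Adj (vtx i) (vtx j) ⇔ CycAdj len i j

  _∈H_ : V → Hole → Set
  x ∈H C = ∃[ i ] Hole.vtx C i ≡ x

  record Antihole : Set where
    field
      len    : ℕ
      len≥6  : 6 ≤ len
      vtx    : Fin len → V
      inj    : Injective _≡_ _≡_ vtx
      adjIff : ∀ i j → Adj (vtx i) (vtx j) ⇔ ((i ≢ j) × ¬ CycAdj len i j)

  record Prism : Set where
    field
      a       : Fin 3 → V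
      b       : Fin 3 → V
      P       : Fin 3 → Path
      triA    : ∀ i j → i ≢ j → Adj (a i) (a j)
      triB    : ∀ i j → i ≢ j → Adj (b i) (b j)
      disjAB  : ∀ i j → a i ≢ b j
      startP  : ∀ i → Path.start (P i) ≡ a i
      endP    : ∀ i → Path.end (P i) ≡ b i
      disjP   : ∀ i j x → i ≢ j → x ∈P P i → ¬ (x ∈P P j)
      onlyE   : ∀ i j x y → i ≢ j → x ∈P P i → y ∈P P j → Adj x y →
                ((x ≡ a i) × (y ≡ a j)) ⊎ ((x ≡ b i) × (y ≡ b j))

  IsOddPrism : Prism → Set
  IsOddPrism Q = ∀ i → Odd (Path.len (Prism.P Q i))

  TwoAdjNbrs : V → Hole → Set
  TwoAdjNbrs v C =
    Σ V λ x → Σ V λ y →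
      x ∈H C × y ∈H C × Adj x y × Adj v x × Adj v y ×
      (∀ z → z ∈H C → Adj v z → (z ≡ x) ⊎ (z ≡ y))

  record Handcuff : Set where
    field
      C₁ C₂   : Hole
      even₁   : Even (Hole.len C₁)
      even₂   : Even (Hole.len C₂)
      p       : Path
      oddP    : Odd (Path.len p)
      disj₁₂  : ∀ x → x ∈H C₁ → ¬ (x ∈H C₂)
      disjP₁  : ∀ x → x ∈P p → ¬ (x ∈H C₁)
      disjP₂  : ∀ x → x ∈P p → ¬ (x ∈H C₂)
      nbrs₁   : TwoAdjNbrs (Path.start p) C₁
      nbrs₂   : TwoAdjNbrs (Path.end p) C₂
      noE₁₂   : ∀ x y → x ∈H C₁ → y ∈H C₂ → ¬ Adj x y
      noEP₁   : ∀ x y → x ∈P p → x ≢ Path.start p → y ∈H C₁ → ¬ Adj x y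
      noEP₂   : ∀ x y → x ∈P p → x ≢ Path.end p → y ∈H C₂ → ¬ Adj x y

  record EyeMask : Set where
    field
      C₁ C₂   : Hole
      even₁   : Even (Hole.len C₁)
      even₂   : Even (Hole.len C₂)
      disj₁₂  : ∀ x → x ∈H C₁ → ¬ (x ∈H C₂)
      x₁ y₁   : V
      x₂ y₂   : V
      x₁∈     : x₁ ∈H C₁
      y₁∈     : y₁ ∈H C₁
      x₂∈     : x₂ ∈H C₂
      y₂∈     : y₂ ∈H C₂
      e₁      : Adj x₁ y₁
      e₂      : Adj x₂ y₂
      complete : ∀ u v → (u ≡ x₁) ⊎ (u ≡ y₁) → (v ≡ x₂) ⊎ (v ≡ y₂) → Adj u v
      onlyE   : ∀ u v → u ∈H C₁ → v ∈H C₂ → Adj u v →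
                ((u ≡ x₁) ⊎ (u ≡ y₁)) × ((v ≡ x₂) ⊎ (v ≡ y₂))

  Innocent : Set
  Innocent =
    (¬ Σ Hole (λ C → Odd (Hole.len C))) ×
    ¬ Antihole ×
    (¬ Σ Prism IsOddPrism) ×
    ¬ Handcuff ×
    ¬ EyeMask

  IsSimplicial : V → Set
  IsSimplicial v = ∀ u w → Adj v u → Adj v w → u ≢ w → Adj u w

  record Clown : Set where
    field
      C      : Hole
      evenC  : Even (Hole.len C)
      hat    : V
      hat∉   : ¬ (hat ∈H C)
      hatAdj : ∀ i → Adj hat (Hole.vtx C i) ⇔ ((toℕ i ≡ 0) ⊎ (toℕ i ≡ 1))

  IsSafe : V → Set
  IsSafe v =
    IsSimplicial v ×
    (∀ (D : Clown) (P : Path) →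
       Path.start P ≡ v → Path.end P ≡ Clown.hat D →
       (∀ x → x ∈P P → x ≢ Clown.hat D →
          ¬ (x ∈H Clown.C D) × (∀ y → y ∈H Clown.C D → ¬ Adj x y)) →
       Odd (Path.len P))

  IsEvenPair : V → V → Set
  IsEvenPair u v = ∀ (P : Path) → Path.start P ≡ u → Path.end P ≡ v → Even (Path.len P)

  IsConsistent : Subset n → Set
  IsConsistent Z = ∀ u v → u ∈ Z → v ∈ Z → u ≢ v → IsEvenPair u v

module Submission where

-- Everything happens in the bipartite complement of G, where u ∼ v when u, v
-- lie on different sides and are non-adjacent in G.  A vertex isolated there,
-- or the ends of a bisimplicial edge pq (every ∼-neighbour of p is ∼-joined to
-- every ∼-neighbour of q), form a strong stable set of G, since a maximal
-- clique missing a vertex contains a ∼-neighbour of it.  Antiholes of G of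
-- length at least six are long holes of the complement, so the complement is
-- chordal bipartite; such graphs have an isolated vertex or a bisimplicial
-- edge, proved here through a weakly simplicial vertex by induction over
-- clusters.  A consistent Z has at most one vertex per side; two of them are
-- the ends of a bisimplicial edge (else an odd induced path joins them), and a
-- lone safe vertex lies on one (else it is the hat of a clown).

open import Defs
open import Data.Bool using (Bool; true; false; if_then_else_)
open import Data.Bool.Properties using (T?; ¬-not) renaming (_≟_ to _≟ᵇ_)
open import Data.Nat using (ℕ; zero; suc; _+_; _∸_; _≤_; _<_; z≤n; s≤s; _≤?_; _<?_)
open import Data.Nat.Properties
  using (anyUpTo?; ≮⇒≥; ≤-pred; m≤n⇒m<n∨m≡n; <⇒≱; ≤-refl; m≤n⇒m≤1+n; <-irrefl; +-comm; ≤-trans; <⇒≤; <-trans; n<1+n; <-cmp; m+[n∸m]≡n; +-monoʳ-≤; +-cancelˡ-≡; +-suc; +-identityʳ; +-monoʳ-<; ≤∧≢⇒<; m+n∸n≡m; ∸-monoˡ-≤; 1+n≢n; suc-injective)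
open import Data.Nat.Divisibility using (_∣?_; divides)
open import Data.Nat.Induction using (<-wellFounded)
open import Induction.WellFounded using (Acc; acc)
open import Data.Fin using (Fin; zero; suc; toℕ; fromℕ<) renaming (_<_ to _<ᶠ_)
open import Data.Fin.Properties using (any?; all?; toℕ<n; toℕ-injective; toℕ-fromℕ<; injective⇒≤)
  renaming (_≟_ to _≟ᶠ_; <-cmp to <ᶠ-cmp)
open import Data.Fin.Subset using (Subset; _∈_; _∉_; _⊆_; ∣_∣; ∁; ⁅_⁆; _∪_) renaming (⊤ to full; ⊥ to ∅)
open import Data.Fin.Subset.Properties
  using (_∈?_; p⊂q⇒∣p∣<∣q∣; ∈⊤; ∉⊥; x∈⁅x⁆; x∈⁅y⁆⇒x≡y; x∈p∪q⁻; x∈p∪q⁺; x∉p⇒x∈∁p)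
open import Data.Vec using (tabulate; lookup)
open import Data.Vec.Properties using (lookup∘tabulate; []=⇒lookup; lookup⇒[]=)
open import Data.Product using (Σ; ∃; _×_; _,_; proj₁; proj₂)
import Data.Sum
open import Data.Sum using (_⊎_; inj₁; inj₂; swap; [_,_])
open import Data.Empty using (⊥; ⊥-elim)
open import Data.Unit using (tt)
open import Relation.Nullary using (¬_; Dec; yes; no; ¬?; does; proof)
open import Relation.Nullary.Decidable using (_×-dec_; _→-dec_; dec-true; toWitnessFalse)
open import Relation.Nullary.Reflects using (Reflects; invert)
open import Relation.Unary using (Pred; Decidable)
open import Relation.Binary.Definitions using (tri<; tri≈; tri>)
open import Relation.Binary.PropositionalEquality using (_≡_; _≢_; refl; sym; trans; cong; subst)
open import Function using (_∘_)
open import Function.Bundles using (_⇔_; mk⇔; Equivalence)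
open import Function.Definitions using (Injective)

module _ {p} {P : Pred ℕ p} (P? : Decidable P) where

  least-below : ∀ L → Acc _<_ L → P L → ∃ λ m → P m × (∀ {k} → k < m → ¬ P k)
  least-below L (acc smaller) pL with anyUpTo? P? L
  ... | yes (m , m<L , pm) = least-below m (smaller m<L) pm
  ... | no none = L , pL , λ k<L pk → none (_ , k<L , pk)

  least : ∀ {L} → P L → ∃ λ m → P m × (∀ {k} → k < m → ¬ P k)
  least = least-below _ (<-wellFounded _)

≤-top : ∀ {i m} → i ≤ suc m → i ≤ m ⊎ i ≡ suc m
≤-top i≤1+m with m≤n⇒m<n∨m≡n i≤1+m
... | inj₁ i<1+m = inj₁ (≤-pred i<1+m)
... | inj₂ i≡1+m = inj₂ i≡1+m

module _ {p} {P : Pred ℕ p} (P? : Decidable P) where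

  greatest : ∀ L → P 0 → ∃ λ j → j ≤ L × P j × (∀ {i} → j < i → i ≤ L → ¬ P i)
  greatest zero p0 = 0 , z≤n , p0 , λ 0<i i≤0 → ⊥-elim (<⇒≱ 0<i i≤0)
  greatest (suc L) p0 with P? (suc L)
  ... | yes pL = suc L , ≤-refl , pL , λ L<i i≤L → ⊥-elim (<⇒≱ L<i i≤L)
  ... | no ¬pL with greatest L p0
  ...   | j , j≤L , pj , after = j , m≤n⇒m≤1+n j≤L , pj , later
    where
    later : ∀ {i} → j < i → i ≤ suc L → ¬ P i
    later j<i i≤1+L with ≤-top i≤1+L
    ... | inj₁ i≤L = after j<i i≤L
    ... | inj₂ refl = ¬pL

module _ {n p} {P : Pred (Fin n) p} (P? : Decidable P) (μ : Fin n → ℕ) where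

  minimiser-below : ∀ x → Acc _<_ (μ x) → P x → ∃ λ m → P m × (∀ {y} → P y → μ m ≤ μ y)
  minimiser-below x (acc smaller) px with any? (λ y → P? y ×-dec μ y <? μ x)
  ... | yes (y , py , μy<μx) = minimiser-below y (smaller μy<μx) py
  ... | no none = x , px , λ {y} py → ≮⇒≥ (λ μy<μx → none (y , py , μy<μx))

  minimiser : ∃ P → ∃ λ m → P m × (∀ {y} → P y → μ m ≤ μ y)
  minimiser (x , px) = minimiser-below x (<-wellFounded _) px

setOf : ∀ {n p} {P : Pred (Fin n) p} → Decidable P → Subset n
setOf P? = tabulate (λ x → does (P? x))

module _ {n p} {P : Pred (Fin n) p} (P? : Decidable P) {x : Fin n} where

  ∈setOf⁺ : P x → x ∈ setOf P?
  ∈setOf⁺ px = lookup⇒[]= x _ (trans (lookup∘tabulate _ x) (dec-true (P? x) px))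

  ∈setOf⁻ : x ∈ setOf P? → P x
  ∈setOf⁻ x∈ = invert (subst (Reflects (P x)) (trans (sym (lookup∘tabulate _ x)) ([]=⇒lookup x∈)) (proof (P? x)))

extend : ∀ {A : Set} → (ℕ → A) → ℕ → A → ℕ → A
extend f m x i with i ≤? m
... | yes _ = f i
... | no _ = x

module _ {A : Set} (f : ℕ → A) (m : ℕ) (x : A) where

  extend-≤ : ∀ {i} → i ≤ m → extend f m x i ≡ f i
  extend-≤ {i} i≤m with i ≤? m
  ... | yes _ = refl
  ... | no i≰m = ⊥-elim (i≰m i≤m)

  extend-top : extend f m x (suc m) ≡ x
  extend-top with suc m ≤? m
  ... | yes m<m = ⊥-elim (<-irrefl refl m<m)
  ... | no _ = refl

module SimpleGraph {n : ℕ} (E : Fin n → Fin n → Set) (E? : ∀ u v → Dec (E u v))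
             (E-sym : ∀ {u v} → E u v → E v u) (E-irrefl : ∀ {u} → ¬ E u u) where

  data Walk (D : Subset n) (a : Fin n) : ℕ → Fin n → Set where
    stay : a ∈ D → Walk D a 0 a
    step : ∀ {L y x} → Walk D a L y → E y x → x ∈ D → Walk D a (suc L) x

  walk? : ∀ D a L x → Dec (Walk D a L x)
  walk? D a zero x with x ≟ᶠ a | a ∈? D
  ... | yes refl | yes a∈D = yes (stay a∈D)
  ... | yes refl | no a∉D = no λ { (stay a∈D) → a∉D a∈D }
  ... | no x≢a | _ = no λ { (stay _) → x≢a refl }
  walk? D a (suc L) x with any? (λ y → walk? D a L y ×-dec E? y x) | x ∈? D
  ... | yes (y , w , e) | yes x∈D = yes (step w e x∈D)
  ... | no none | _ = no λ { (step w e _) → none (_ , w , e) }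
  ... | _ | no x∉D = no λ { (step _ _ x∈D) → x∉D x∈D }

  walk-start : ∀ {D a L x} → Walk D a L x → a ∈ D
  walk-start (stay a∈D) = a∈D
  walk-start (step w _ _) = walk-start w

  walk-end : ∀ {D a L x} → Walk D a L x → x ∈ D
  walk-end (stay a∈D) = a∈D
  walk-end (step _ _ x∈D) = x∈D

  walk-length0 : ∀ {D a x} → Walk D a 0 x → x ≡ a
  walk-length0 (stay _) = refl

  _▸_ : ∀ {D a b c L₁ L₂} → Walk D a L₁ b → Walk D b L₂ c → Walk D a (L₂ + L₁) c
  w ▸ stay _ = w
  w ▸ step w′ e c∈D = step (w ▸ w′) e c∈D

  reverse : ∀ {D a L x} → Walk D a L x → Walk D x L a
  reverse (stay a∈D) = stay a∈D
  reverse {D} {a} (step {L} {y} {x} w e x∈D) =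
    subst (λ k → Walk D x k a) (+-comm L 1) (step (stay x∈D) (E-sym e) (walk-end w) ▸ reverse w)

  record Geodesic (D : Subset n) (a : Fin n) (L : ℕ) (x : Fin n) : Set where
    field
      at       : ℕ → Fin n
      at-end   : at L ≡ x
      at-step  : ∀ i → i < L → E (at i) (at (suc i))
      prefix   : ∀ i → i ≤ L → Walk D a i (at i)
      distance : ∀ i → i ≤ L → ∀ k → k < i → ¬ Walk D a k (at i)

    at-start : at 0 ≡ a
    at-start = walk-length0 (prefix 0 z≤n)

    at-in : ∀ i → i ≤ L → at i ∈ D
    at-in i i≤L = walk-end (prefix i i≤L)

    -- no vertex is repeated: the later one would be reachable too early
    at-distinct : ∀ i j → i < j → j ≤ L → at i ≢ at j
    at-distinct i j i<j j≤L at-i≡at-j =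
      distance j j≤L i i<j (subst (Walk D a i) at-i≡at-j (prefix i (≤-trans (<⇒≤ i<j) j≤L)))

    -- no chords: a chord would give a shortcut to the later vertex
    at-chordless : ∀ i j → suc i < j → j ≤ L → ¬ E (at i) (at j)
    at-chordless i j 1+i<j j≤L e =
      distance j j≤L (suc i) 1+i<j (step (prefix i (≤-trans (<⇒≤ (<-trans (n<1+n i) 1+i<j)) j≤L)) e (at-in j j≤L))

  geodesic : ∀ {D a L x} → Walk D a L x → (∀ k → k < L → ¬ Walk D a k x) → Geodesic D a L x
  geodesic {a = a} (stay a∈D) _ = record
    { at = λ _ → a ; at-end = refl ; at-step = λ _ ()
    ; prefix = λ { zero _ → stay a∈D } ; distance = λ { zero _ _ () } }
  geodesic {D} {a} {suc L} {x} (step {y = y} w e x∈D) shortest = record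
    { at = at ; at-end = extend-top (G.at) L x ; at-step = at-step
    ; prefix = prefix ; distance = distance }
    where
    G : Geodesic D a L y
    G = geodesic w (λ k k<L w′ → shortest (suc k) (s≤s k<L) (step w′ e x∈D))
    module G = Geodesic G
    at : ℕ → Fin n
    at = extend G.at L x
    at-step : ∀ i → i < suc L → E (at i) (at (suc i))
    at-step i i<1+L with ≤-top i<1+L
    ... | inj₁ 1+i≤L rewrite extend-≤ G.at L x (<⇒≤ 1+i≤L) | extend-≤ G.at L x 1+i≤L = G.at-step i 1+i≤L
    ... | inj₂ refl rewrite extend-≤ G.at L x ≤-refl | extend-top G.at L x | G.at-end = e
    prefix : ∀ i → i ≤ suc L → Walk D a i (at i)
    prefix i i≤1+L with ≤-top i≤1+L
    ... | inj₁ i≤L rewrite extend-≤ G.at L x i≤L = G.prefix i i≤L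
    ... | inj₂ refl rewrite extend-top G.at L x = step w e x∈D
    distance : ∀ i → i ≤ suc L → ∀ k → k < i → ¬ Walk D a k (at i)
    distance i i≤1+L with ≤-top i≤1+L
    ... | inj₁ i≤L rewrite extend-≤ G.at L x i≤L = G.distance i i≤L
    ... | inj₂ refl rewrite extend-top G.at L x = shortest

  -- Every vertex reachable in D is reachable in fewer than n steps: a
  -- shortest walk is a geodesic, and its vertices are distinct.
  short-walk : ∀ {D a L x} → Walk D a L x → ∃ λ (k : Fin n) → Walk D a (toℕ k) x
  short-walk {D} {a} {x = x} w with least (λ k → walk? D a k x) w
  ... | L , w′ , shortest = fromℕ< L<n , subst (λ k → Walk D a k x) (sym (toℕ-fromℕ< L<n)) w′
    where
    open Geodesic (geodesic w′ (λ k k<L → shortest k<L))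
    bound : ∀ (i : Fin (suc L)) → toℕ i ≤ L
    bound i = ≤-pred (toℕ<n i)
    injective : ∀ {i j : Fin (suc L)} → at (toℕ i) ≡ at (toℕ j) → i ≡ j
    injective {i} {j} eq with <-cmp (toℕ i) (toℕ j)
    ... | tri< i<j _ _ = ⊥-elim (at-distinct _ _ i<j (bound j) eq)
    ... | tri≈ _ i≡j _ = toℕ-injective i≡j
    ... | tri> _ _ j<i = ⊥-elim (at-distinct _ _ j<i (bound i) (sym eq))
    L<n : L < n
    L<n = injective⇒≤ injective

  Connected : Subset n → Set
  Connected D = ∀ {p q} → p ∈ D → q ∈ D → ∃ λ L → Walk D p L q

  reachable? : ∀ D a x → Dec (∃ λ (k : Fin n) → Walk D a (toℕ k) x)
  reachable? D a x = any? (λ k → walk? D a (toℕ k) x)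

  component : Subset n → Fin n → Subset n
  component D a = setOf (reachable? D a)

  module _ {D : Subset n} {a : Fin n} where

    ∈component⁺ : ∀ {L x} → Walk D a L x → x ∈ component D a
    ∈component⁺ w = ∈setOf⁺ (reachable? D a) (short-walk w)

    ∈component⁻ : ∀ {x} → x ∈ component D a → ∃ λ L → Walk D a L x
    ∈component⁻ x∈C with ∈setOf⁻ (reachable? D a) x∈C
    ... | k , w = toℕ k , w

    component-⊆ : ∀ {x} → x ∈ component D a → x ∈ D
    component-⊆ x∈C = walk-end (proj₂ (∈component⁻ x∈C))

    component-root : a ∈ D → a ∈ component D a
    component-root a∈D = ∈component⁺ (stay a∈D)

    component-closed : ∀ {x y} → x ∈ component D a → y ∈ D → E x y → y ∈ component D a
    component-closed x∈C y∈D e = ∈component⁺ (step (proj₂ (∈component⁻ x∈C)) e y∈D)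

    within-component : ∀ {b L x} → b ∈ component D a → Walk D b L x → Walk (component D a) b L x
    within-component b∈C (stay _) = stay b∈C
    within-component b∈C (step w e x∈D) =
      step (within-component b∈C w) e (component-closed (walk-end (within-component b∈C w)) x∈D e)

    component-connected : Connected (component D a)
    component-connected p∈C q∈C with ∈component⁻ p∈C | ∈component⁻ q∈C
    ... | Lp , wp | Lq , wq = _ , reverse (within-component a∈C wp) ▸ within-component a∈C wq
      where
      a∈C : a ∈ component D a
      a∈C = component-root (walk-start wp)

  record InducedPath : Set where
    field
      m         : ℕ
      f         : ℕ → Fin n
      distinct  : ∀ i j → i ≤ m → j ≤ m → f i ≡ f j → i ≡ j
      edge      : ∀ i → i < m → E (f i) (f (suc i))
      chordless : ∀ i j → i ≤ m → j ≤ m → E (f i) (f j) → suc i ≡ j ⊎ suc j ≡ i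

  record LongHole : Set where
    field
      m         : ℕ
      5≤m       : 5 ≤ m
      g         : ℕ → Fin n
      distinct  : ∀ i j → i ≤ m → j ≤ m → g i ≡ g j → i ≡ j
      edge      : ∀ i → i < m → E (g i) (g (suc i))
      wrap      : E (g m) (g 0)
      chordless : ∀ i j → i ≤ m → j ≤ m → E (g i) (g j) →
                  suc i ≡ j ⊎ suc j ≡ i ⊎ (i ≡ 0 × j ≡ m) ⊎ (j ≡ 0 × i ≡ m)

  segment : ∀ {D a L x} → Geodesic D a L x → ∀ j → j ≤ L → InducedPath
  segment {L = L} G j j≤L = record
    { m = L ∸ j ; f = λ k → at (j + k) ; distinct = distinct ; edge = edge ; chordless = chordless }
    where
    open Geodesic G
    inside : ∀ {k} → k ≤ L ∸ j → j + k ≤ L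
    inside k≤ = subst (_ ≤_) (m+[n∸m]≡n j≤L) (+-monoʳ-≤ j k≤)
    distinct : ∀ i k → i ≤ L ∸ j → k ≤ L ∸ j → at (j + i) ≡ at (j + k) → i ≡ k
    distinct i k i≤ k≤ eq with <-cmp (j + i) (j + k)
    ... | tri< lt _ _ = ⊥-elim (at-distinct _ _ lt (inside k≤) eq)
    ... | tri≈ _ same _ = +-cancelˡ-≡ j i k same
    ... | tri> _ _ gt = ⊥-elim (at-distinct _ _ gt (inside i≤) (sym eq))
    edge : ∀ i → i < L ∸ j → E (at (j + i)) (at (j + suc i))
    edge i i< rewrite +-suc j i = at-step (j + i) (subst (_≤ L) (+-suc j i) (inside i<))
    chordless : ∀ i k → i ≤ L ∸ j → k ≤ L ∸ j → E (at (j + i)) (at (j + k)) → suc i ≡ k ⊎ suc k ≡ i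
    chordless i k i≤ k≤ e with <-cmp (j + i) (j + k)
    ... | tri≈ _ same _ rewrite same = ⊥-elim (E-irrefl e)
    ... | tri< lt _ _ with m≤n⇒m<n∨m≡n lt
    ...   | inj₁ far = ⊥-elim (at-chordless _ _ far (inside k≤) e)
    ...   | inj₂ next = inj₁ (+-cancelˡ-≡ j (suc i) k (trans (+-suc j i) next))
    chordless i k i≤ k≤ e | tri> _ _ gt with m≤n⇒m<n∨m≡n gt
    ...   | inj₁ far = ⊥-elim (at-chordless _ _ far (inside i≤) (E-sym e))
    ...   | inj₂ next = inj₂ (+-cancelˡ-≡ j (suc k) i (trans (+-suc j k) next))

  cons : (P : InducedPath) (x : Fin n) → let open InducedPath P in
    E x (f 0) → (∀ i → 0 < i → i ≤ m → ¬ E x (f i)) → (∀ i → i ≤ m → x ≢ f i) → InducedPath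
  cons P x x~f0 x≁ x∉ = record
    { m = suc m ; f = f′ ; distinct = distinct′ ; edge = edge′ ; chordless = chordless′ }
    where
    open InducedPath P
    f′ : ℕ → Fin n
    f′ zero = x
    f′ (suc i) = f i
    distinct′ : ∀ i j → i ≤ suc m → j ≤ suc m → f′ i ≡ f′ j → i ≡ j
    distinct′ zero zero _ _ _ = refl
    distinct′ zero (suc j) _ j≤ eq = ⊥-elim (x∉ j (≤-pred j≤) eq)
    distinct′ (suc i) zero i≤ _ eq = ⊥-elim (x∉ i (≤-pred i≤) (sym eq))
    distinct′ (suc i) (suc j) i≤ j≤ eq = cong suc (distinct i j (≤-pred i≤) (≤-pred j≤) eq)
    edge′ : ∀ i → i < suc m → E (f′ i) (f′ (suc i))
    edge′ zero _ = x~f0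
    edge′ (suc i) i< = edge i (≤-pred i<)
    chordless′ : ∀ i j → i ≤ suc m → j ≤ suc m → E (f′ i) (f′ j) → suc i ≡ j ⊎ suc j ≡ i
    chordless′ zero zero _ _ e = ⊥-elim (E-irrefl e)
    chordless′ zero (suc zero) _ _ _ = inj₁ refl
    chordless′ zero (suc (suc j)) _ j≤ e = ⊥-elim (x≁ (suc j) (s≤s z≤n) (≤-pred j≤) e)
    chordless′ (suc zero) zero _ _ _ = inj₂ refl
    chordless′ (suc (suc i)) zero i≤ _ e = ⊥-elim (x≁ (suc i) (s≤s z≤n) (≤-pred i≤) (E-sym e))
    chordless′ (suc i) (suc j) i≤ j≤ e with chordless i j (≤-pred i≤) (≤-pred j≤) e
    ... | inj₁ next = inj₁ (cong suc next)
    ... | inj₂ next = inj₂ (cong suc next)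

  module Extension (f : ℕ → Fin n) (m : ℕ) (x : Fin n) where
    f′ : ℕ → Fin n
    f′ = extend f m x

    distinct′ : (∀ i j → i ≤ m → j ≤ m → f i ≡ f j → i ≡ j) → (∀ i → i ≤ m → f i ≢ x) →
                ∀ i j → i ≤ suc m → j ≤ suc m → f′ i ≡ f′ j → i ≡ j
    distinct′ distinct x∉ i j i≤ j≤ eq with ≤-top i≤ | ≤-top j≤
    ... | inj₁ i≤m | inj₁ j≤m rewrite extend-≤ f m x i≤m | extend-≤ f m x j≤m = distinct i j i≤m j≤m eq
    ... | inj₁ i≤m | inj₂ refl rewrite extend-≤ f m x i≤m | extend-top f m x = ⊥-elim (x∉ i i≤m eq)
    ... | inj₂ refl | inj₁ j≤m rewrite extend-≤ f m x j≤m | extend-top f m x = ⊥-elim (x∉ j j≤m (sym eq))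
    ... | inj₂ refl | inj₂ refl = refl

    edge′ : (∀ i → i < m → E (f i) (f (suc i))) → E (f m) x → ∀ i → i < suc m → E (f′ i) (f′ (suc i))
    edge′ edge fm~x i i< with ≤-top i<
    ... | inj₁ 1+i≤m rewrite extend-≤ f m x (<⇒≤ 1+i≤m) | extend-≤ f m x 1+i≤m = edge i 1+i≤m
    ... | inj₂ refl rewrite extend-≤ f m x ≤-refl | extend-top f m x = fm~x

    old-new : ∀ {i} → i ≤ m → E (f′ i) (f′ (suc m)) → E (f i) x
    old-new i≤m e rewrite extend-≤ f m x i≤m | extend-top f m x = e

    old-old : ∀ {i j} → i ≤ m → j ≤ m → E (f′ i) (f′ j) → E (f i) (f j)
    old-old i≤m j≤m e rewrite extend-≤ f m x i≤m | extend-≤ f m x j≤m = e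

  snoc : (P : InducedPath) (x : Fin n) → let open InducedPath P in
    E (f m) x → (∀ i → i < m → ¬ E (f i) x) → (∀ i → i ≤ m → f i ≢ x) → InducedPath
  snoc P x fm~x f≁x x∉ = record
    { m = suc m ; f = f′ ; distinct = distinct′ distinct x∉ ; edge = edge′ edge fm~x ; chordless = chordless′ }
    where
    open InducedPath P
    open Extension f m x
    only-last : ∀ {i} → i ≤ m → E (f i) x → suc i ≡ suc m
    only-last i≤m e with m≤n⇒m<n∨m≡n i≤m
    ... | inj₁ i<m = ⊥-elim (f≁x _ i<m e)
    ... | inj₂ refl = refl
    chordless′ : ∀ i j → i ≤ suc m → j ≤ suc m → E (f′ i) (f′ j) → suc i ≡ j ⊎ suc j ≡ i
    chordless′ i j i≤ j≤ e with ≤-top i≤ | ≤-top j≤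
    ... | inj₁ i≤m | inj₁ j≤m = chordless i j i≤m j≤m (old-old i≤m j≤m e)
    ... | inj₁ i≤m | inj₂ refl = inj₁ (only-last i≤m (old-new i≤m e))
    ... | inj₂ refl | inj₁ j≤m = inj₂ (only-last j≤m (old-new j≤m (E-sym e)))
    ... | inj₂ refl | inj₂ refl = ⊥-elim (E-irrefl e)

  close : (P : InducedPath) (x : Fin n) → let open InducedPath P in
    4 ≤ m → E x (f 0) → E (f m) x → (∀ i → 0 < i → i < m → ¬ E (f i) x) →
    (∀ i → i ≤ m → f i ≢ x) → LongHole
  close P x 4≤m x~f0 fm~x f≁x x∉ = record
    { m = suc m ; 5≤m = s≤s 4≤m ; g = f′ ; distinct = distinct′ distinct x∉
    ; edge = edge′ edge fm~x ; wrap = wrap ; chordless = chordless′ }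
    where
    open InducedPath P
    open Extension f m x
    wrap : E (f′ (suc m)) (f′ 0)
    wrap rewrite extend-top f m x | extend-≤ f m x z≤n = x~f0
    ends : ∀ {i} → i ≤ m → E (f i) x → i ≡ 0 ⊎ suc i ≡ suc m
    ends {zero} _ _ = inj₁ refl
    ends {suc i} i≤m e with m≤n⇒m<n∨m≡n i≤m
    ... | inj₁ i<m = ⊥-elim (f≁x (suc i) (s≤s z≤n) i<m e)
    ... | inj₂ refl = inj₂ refl
    chordless′ : ∀ i j → i ≤ suc m → j ≤ suc m → E (f′ i) (f′ j) →
                 suc i ≡ j ⊎ suc j ≡ i ⊎ (i ≡ 0 × j ≡ suc m) ⊎ (j ≡ 0 × i ≡ suc m)
    chordless′ i j i≤ j≤ e with ≤-top i≤ | ≤-top j≤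
    ... | inj₁ i≤m | inj₁ j≤m with chordless i j i≤m j≤m (old-old i≤m j≤m e)
    ...   | inj₁ next = inj₁ next
    ...   | inj₂ next = inj₂ (inj₁ next)
    chordless′ i j i≤ j≤ e | inj₁ i≤m | inj₂ refl with ends i≤m (old-new i≤m e)
    ...   | inj₁ refl = inj₂ (inj₂ (inj₁ (refl , refl)))
    ...   | inj₂ next = inj₁ next
    chordless′ i j i≤ j≤ e | inj₂ refl | inj₁ j≤m with ends j≤m (old-new j≤m (E-sym e))
    ...   | inj₁ refl = inj₂ (inj₂ (inj₂ (refl , refl)))
    ...   | inj₂ next = inj₂ (inj₁ next)
    chordless′ i j i≤ j≤ e | inj₂ refl | inj₂ refl = ⊥-elim (E-irrefl e)

  neighbourhood : Fin n → Subset n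
  neighbourhood a = setOf (E? a)

  -- Among the neighbours of p there is one, q, whose neighbourhood contains
  -- the neighbourhood of no other neighbour of p properly: take q with the
  -- fewest neighbours.
  minimal-neighbour : ∀ {p q₀} → E p q₀ → ∃ λ q → E p q ×
    (∀ {k} → E p k → (∀ {x} → E k x → E q x) → ∀ {x} → E q x → E k x)
  minimal-neighbour p~q₀ with minimiser (E? _) (λ q → ∣ neighbourhood q ∣) (_ , p~q₀)
  ... | q , p~q , fewest = q , p~q , contained
    where
    contained : ∀ {k} → E _ k → (∀ {x} → E k x → E q x) → ∀ {x} → E q x → E k x
    contained {k} p~k k≼q {x} q~x with E? k x
    ... | yes k~x = k~x
    ... | no k≁x = ⊥-elim (<⇒≱ (p⊂q⇒∣p∣<∣q∣ (N[k]⊆N[q] , x , ∈setOf⁺ (E? q) q~x , k≁x ∘ ∈setOf⁻ (E? k)))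
                                (fewest p~k))
      where
      N[k]⊆N[q] : neighbourhood k ⊆ neighbourhood q
      N[k]⊆N[q] y∈ = ∈setOf⁺ (E? q) (k≼q (∈setOf⁻ (E? k) y∈))

module Bipartite {n : ℕ} (E : Fin n → Fin n → Set) (E? : ∀ u v → Dec (E u v))
                 (E-sym : ∀ {u v} → E u v → E v u) (E-irrefl : ∀ {u} → ¬ E u u)
                 (side : Fin n → Bool) (crossing : ∀ {u v} → E u v → side u ≢ side v) where

  open SimpleGraph E E? E-sym E-irrefl public

  two-step-side : ∀ {u v w} → E u v → E v w → side u ≡ side w
  two-step-side u~v v~w = trans (¬-not (crossing u~v)) (sym (¬-not (crossing (E-sym v~w))))

  same-side-¬E : ∀ {u v} → side u ≡ side v → ¬ E u v
  same-side-¬E same u~v = crossing u~v same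

  _≼⟨_⟩_ : Fin n → Subset n → Fin n → Set
  a ≼⟨ U ⟩ b = ∀ {x} → x ∈ U → E a x → E b x

  WeaklySimplicial : Subset n → Fin n → Set
  WeaklySimplicial U w = ∀ {y₁ y₂} → y₁ ∈ U → y₂ ∈ U → E w y₁ → E w y₂ → y₁ ≼⟨ U ⟩ y₂ ⊎ y₂ ≼⟨ U ⟩ y₁

  Bisimplicial : Fin n → Fin n → Set
  Bisimplicial p q = E p q × (∀ {k k′} → E p k → E q k′ → E k k′)

  record Cluster (U C S : Subset n) : Set where
    field
      C⊆U       : C ⊆ U
      S⊆U       : S ⊆ U
      disjoint  : ∀ {x} → x ∈ C → x ∉ S
      connected : Connected C
      closed    : ∀ {c y} → c ∈ C → y ∈ U → E c y → y ∈ C ⊎ y ∈ S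
      attached  : ∀ {s} → s ∈ S → ∃ λ c → c ∈ C × E s c
      linked    : ∀ {s t} → s ∈ S → t ∈ S → s ≢ t → ∃ λ v → v ∈ U × v ∉ C × E v s × E v t

    S-one-side : ∀ {s t} → s ∈ S → t ∈ S → s ≢ t → side s ≡ side t
    S-one-side s∈S t∈S s≢t with linked s∈S t∈S s≢t
    ... | _ , _ , _ , v~s , v~t = two-step-side (E-sym v~s) v~t

    outsider-blind : ∀ {v s c} → v ∈ U → v ∉ C → s ∈ S → E v s → c ∈ C → ¬ E v c
    outsider-blind v∈U v∉C s∈S v~s c∈C v~c with closed c∈C v∈U (E-sym v~c)
    ... | inj₁ v∈C = v∉C v∈C
    ... | inj₂ v∈S = same-side-¬E (S-one-side v∈S s∈S (λ { refl → E-irrefl v~s })) v~s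

  NoNeighbourIn : Subset n → Fin n → Set
  NoNeighbourIn S z = ∀ {y} → y ∈ S → ¬ E z y

  module Chordal (no-long-hole : ¬ LongHole) where

    module _ {U C S} (cl : Cluster U C S) where
      open Cluster cl

      -- Then t, the part of G from at j
      -- on, s and a common neighbour v of s and t outside C form a long hole.
      module CrossingHole {c L x₀ s t} (G : Geodesic C c L x₀) (s∈S : s ∈ S) (t∈S : t ∈ S)
               (s~x₀ : E s x₀) (s≁earlier : ∀ i → i < L → ¬ E s (Geodesic.at G i)) (t≁x₀ : ¬ E t x₀)
               (j : ℕ) (j≤L : j ≤ L) (t~at-j : E t (Geodesic.at G j))
               (t≁later : ∀ {i} → j < i → i ≤ L → ¬ E t (Geodesic.at G i)) where
        open Geodesic G

        j<L : j < L
        j<L = ≤∧≢⇒< j≤L (λ { refl → t≁x₀ (subst (E t) at-end t~at-j) })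

        t≢s : t ≢ s
        t≢s refl = s≁earlier j j<L t~at-j

        -- by parity, the part of G from at j to x₀ has at least two edges
        2≤L∸j : 2 ≤ L ∸ j
        2≤L∸j with m≤n⇒m<n∨m≡n j<L
        ... | inj₁ 2+j≤L = subst (_≤ L ∸ j) (m+n∸n≡m 2 j) (∸-monoˡ-≤ j 2+j≤L)
        ... | inj₂ refl = ⊥-elim (crossing (E-sym s~x₀)
                (trans (sym (two-step-side t~at-j (subst (E (at j)) at-end (at-step j ≤-refl))))
                       (S-one-side t∈S s∈S t≢s)))

        inside : ∀ {i} → i ≤ L ∸ j → j + i ≤ L
        inside i≤ = subst (_ ≤_) (m+[n∸m]≡n j≤L) (+-monoʳ-≤ j i≤)

        in-C : ∀ {i} → i ≤ L ∸ j → at (j + i) ∈ C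
        in-C i≤ = at-in _ (inside i≤)

        path₁ : InducedPath
        path₁ = cons (segment G j j≤L) t
          (subst (E t ∘ at) (sym (+-identityʳ j)) t~at-j)
          (λ i 0<i i≤ → t≁later (subst (_< j + i) (+-identityʳ j) (+-monoʳ-< j 0<i)) (inside i≤))
          (λ i i≤ t≡ → disjoint (in-C i≤) (subst (_∈ S) t≡ t∈S))
        open InducedPath path₁ using () renaming (m to m₁; f to f₁)

        path₂ : InducedPath
        path₂ = snoc path₁ s
          (subst (λ k → E (at k) s) (sym (m+[n∸m]≡n j≤L)) (subst (λ y → E y s) (sym at-end) (E-sym s~x₀)))
          (λ { zero _ → same-side-¬E (S-one-side t∈S s∈S t≢s)
             ; (suc i) i< e → s≁earlier (j + i) (subst (j + i <_) (m+[n∸m]≡n j≤L) (+-monoʳ-< j (≤-pred i<))) (E-sym e) })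
          (λ { zero _ → t≢s ; (suc i) i≤ eq → disjoint (in-C (≤-pred i≤)) (subst (_∈ S) (sym eq) s∈S) })
        open InducedPath path₂ using () renaming (f to f₂)

        f₂-old : ∀ {i} → i ≤ m₁ → f₂ i ≡ f₁ i
        f₂-old = extend-≤ f₁ m₁ s

        hole : ∀ {v} → v ∈ U → v ∉ C → E v s → E v t → LongHole
        hole {v} v∈U v∉C v~s v~t = close path₂ v (s≤s (s≤s 2≤L∸j))
          (subst (E v) (sym (f₂-old z≤n)) v~t)
          (subst (λ y → E y v) (sym (extend-top f₁ m₁ s)) (E-sym v~s))
          (λ { zero () _
             ; (suc i) _ i< e → outsider-blind v∈U v∉C s∈S v~s (in-C (≤-pred (≤-pred i<)))
                                  (E-sym (subst (λ y → E y v) (f₂-old (≤-pred i<)) e)) })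
          v∉
          where
          v∉ : ∀ i → i ≤ suc m₁ → f₂ i ≢ v
          v∉ i i≤ with ≤-top i≤
          ... | inj₂ refl = λ eq → E-irrefl (subst (E v) (trans (sym (extend-top f₁ m₁ s)) eq) v~s)
          ... | inj₁ i≤m₁ rewrite f₂-old i≤m₁ with i
          ...   | zero = λ { refl → E-irrefl v~t }
          ...   | suc i′ = λ eq → v∉C (subst (_∈ C) eq (in-C (≤-pred i≤m₁)))

      no-crossing-attachments : ∀ {c L x₀ s t} (G : Geodesic C c L x₀) → s ∈ S → t ∈ S →
        E s x₀ → (∀ i → i < L → ¬ E s (Geodesic.at G i)) → E t c → ¬ E t x₀ → ⊥
      no-crossing-attachments {t = t} G s∈S t∈S s~x₀ s≁earlier t~c t≁x₀
        with greatest (λ i → E? t (Geodesic.at G i)) _ (subst (E t) (sym (Geodesic.at-start G)) t~c)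
      ... | j , j≤L , t~at-j , t≁later
        with linked t∈S s∈S (CrossingHole.t≢s G s∈S t∈S s~x₀ s≁earlier t≁x₀ j j≤L t~at-j t≁later)
      ... | v , v∈U , v∉C , v~t , v~s =
        no-long-hole (CrossingHole.hole G s∈S t∈S s~x₀ s≁earlier t≁x₀ j j≤L t~at-j t≁later v∈U v∉C v~s v~t)

      nearest-neighbour : ∀ {c c′ s L} → Walk C c L c′ → E s c′ →
        ∃ λ L₀ → ∃ λ x₀ → E s x₀ × Σ (Geodesic C c L₀ x₀) λ G → ∀ i → i < L₀ → ¬ E s (Geodesic.at G i)
      nearest-neighbour {c} {c′} {s} w s~c′ with least (λ L → any? (λ x → E? s x ×-dec walk? C c L x)) (c′ , s~c′ , w)
      ... | L₀ , (x₀ , s~x₀ , w₀) , nearer = L₀ , x₀ , s~x₀ , G , s≁earlier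
        where
        G : Geodesic C c L₀ x₀
        G = geodesic w₀ (λ k k<L₀ w′ → nearer k<L₀ (x₀ , s~x₀ , w′))
        s≁earlier : ∀ i → i < L₀ → ¬ E s (Geodesic.at G i)
        s≁earlier i i<L₀ s~at-i = nearer i<L₀ (_ , s~at-i , Geodesic.prefix G i (<⇒≤ i<L₀))

      missed? : ∀ c s → Dec (s ∈ S × ¬ E c s)
      missed? c s = s ∈? S ×-dec ¬? (E? c s)

      missed : Fin n → Subset n
      missed c = setOf (missed? c)

      -- Otherwise
      -- let s be missed and x₀ a nearest neighbour of s in C; as x₀ misses no
      -- fewer attachments than c, some attachment t is adjacent to c but not to
      -- x₀, which is impossible.
      fewest-missed : ∀ {c s} → c ∈ C → (∀ {y} → y ∈ C → ∣ missed c ∣ ≤ ∣ missed y ∣) → s ∈ S → E c s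
      fewest-missed {c} {s} c∈C fewest s∈S with E? c s
      ... | yes c~s = c~s
      ... | no c≁s with attached s∈S
      ... | c′ , c′∈C , s~c′ with nearest-neighbour (proj₂ (connected c∈C c′∈C)) s~c′
      ... | L₀ , x₀ , s~x₀ , G , s≁earlier with any? (λ t → t ∈? S ×-dec E? c t ×-dec ¬? (E? x₀ t))
      ...   | yes (t , t∈S , c~t , x₀≁t) =
        ⊥-elim (no-crossing-attachments G s∈S t∈S s~x₀ s≁earlier (E-sym c~t) (x₀≁t ∘ E-sym))
      ...   | no none = ⊥-elim (<⇒≱ (p⊂q⇒∣p∣<∣q∣ (fewer , s , s∈missed-c , s∉missed-x₀))
                                     (fewest x₀∈C))
        where
        x₀∈C : x₀ ∈ C
        x₀∈C = subst (_∈ C) (Geodesic.at-end G) (Geodesic.at-in G L₀ ≤-refl)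
        fewer : missed x₀ ⊆ missed c
        fewer u∈ with ∈setOf⁻ (missed? x₀) u∈
        ... | u∈S , x₀≁u = ∈setOf⁺ (missed? c) (u∈S , λ c~u → none (_ , u∈S , c~u , x₀≁u))
        s∈missed-c : s ∈ missed c
        s∈missed-c = ∈setOf⁺ (missed? c) (s∈S , c≁s)
        s∉missed-x₀ : s ∉ missed x₀
        s∉missed-x₀ s∈ = proj₂ (∈setOf⁻ (missed? x₀) s∈) (E-sym s~x₀)

      dominating-vertex : ∃ (_∈ C) → ∃ λ w → w ∈ C × (∀ {s} → s ∈ S → E w s)
      dominating-vertex nonempty with minimiser (_∈? C) (λ c → ∣ missed c ∣) nonempty
      ... | w , w∈C , fewest = w , w∈C , fewest-missed w∈C fewest

    Far : Subset n → Subset n → Set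
    Far C S = ∃ λ z → z ∈ C × NoNeighbourIn S z

    Result : Subset n → Subset n → Subset n → Set
    Result U C S = ∃ λ w → w ∈ C × NoNeighbourIn S w × WeaklySimplicial U w

    Smaller : ℕ → Set
    Smaller k = ∀ {U′ C′ S′} → ∣ C′ ∣ < k → Cluster U′ C′ S′ → Far C′ S′ → Result U′ C′ S′

    shrinks : ∀ {C C′ : Subset n} {w} → C′ ⊆ C → w ∈ C → w ∉ C′ → ∣ C′ ∣ < ∣ C ∣
    shrinks C′⊆C w∈C w∉C′ = p⊂q⇒∣p∣<∣q∣ (C′⊆C , _ , w∈C , w∉C′)

    -- The smaller cluster is the component
    -- C₁ of z₁ in C minus w₁ and its neighbours, with the neighbours of w₁ next
    -- to C₁ as attachments (w₁ links them); z₁ has no neighbour among them by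
    -- parity.
    module SplitOff {U C S w₁ z₁} (cl : Cluster U C S) (w₁∈C : w₁ ∈ C)
                    (dominates : ∀ {s} → s ∈ S → E w₁ s) (z₁∈C : z₁ ∈ C)
                    (far-side : side z₁ ≢ side w₁) (w₁≁z₁ : ¬ E w₁ z₁) where
      open Cluster cl

      D₁? : ∀ x → Dec (x ∈ C × x ≢ w₁ × ¬ E w₁ x)
      D₁? x = x ∈? C ×-dec ¬? (x ≟ᶠ w₁) ×-dec ¬? (E? w₁ x)

      C₁ : Subset n
      C₁ = component (setOf D₁?) z₁

      S₁? : ∀ y → Dec (y ∈ U × E w₁ y × ∃ λ c → c ∈ C₁ × E c y)
      S₁? y = y ∈? U ×-dec E? w₁ y ×-dec any? (λ c → c ∈? C₁ ×-dec E? c y)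

      S₁ : Subset n
      S₁ = setOf S₁?

      C₁⁻ : ∀ {x} → x ∈ C₁ → x ∈ C × x ≢ w₁ × ¬ E w₁ x
      C₁⁻ = ∈setOf⁻ D₁? ∘ component-⊆

      S₁⁺ : ∀ {c y} → y ∈ U → E w₁ y → c ∈ C₁ → E c y → y ∈ S₁
      S₁⁺ y∈U w₁~y c∈C₁ c~y = ∈setOf⁺ S₁? (y∈U , w₁~y , _ , c∈C₁ , c~y)

      S₁⁻ : ∀ {y} → y ∈ S₁ → y ∈ U × E w₁ y × ∃ λ c → c ∈ C₁ × E c y
      S₁⁻ = ∈setOf⁻ S₁?

      closed₁ : ∀ {c y} → c ∈ C₁ → y ∈ U → E c y → y ∈ C₁ ⊎ y ∈ S₁
      closed₁ {c} {y} c∈C₁ y∈U c~y with C₁⁻ c∈C₁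
      ... | c∈C , _ , w₁≁c with closed c∈C y∈U c~y | E? w₁ y | y ≟ᶠ w₁
      ...   | inj₂ y∈S | _ | _ = inj₂ (S₁⁺ y∈U (dominates y∈S) c∈C₁ c~y)
      ...   | inj₁ _ | yes w₁~y | _ = inj₂ (S₁⁺ y∈U w₁~y c∈C₁ c~y)
      ...   | inj₁ _ | no _ | yes refl = ⊥-elim (w₁≁c (E-sym c~y))
      ...   | inj₁ y∈C | no w₁≁y | no y≢w₁ =
        inj₁ (component-closed c∈C₁ (∈setOf⁺ D₁? (y∈C , y≢w₁ , w₁≁y)) c~y)

      cluster : Cluster U C₁ S₁
      cluster = record
        { C⊆U = C⊆U ∘ proj₁ ∘ C₁⁻
        ; S⊆U = proj₁ ∘ S₁⁻
        ; disjoint = λ x∈C₁ x∈S₁ → proj₂ (proj₂ (C₁⁻ x∈C₁)) (proj₁ (proj₂ (S₁⁻ x∈S₁)))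
        ; connected = component-connected
        ; closed = closed₁
        ; attached = λ s∈S₁ → let (c , c∈C₁ , c~s) = proj₂ (proj₂ (S₁⁻ s∈S₁)) in c , c∈C₁ , E-sym c~s
        ; linked = λ s∈S₁ t∈S₁ _ → w₁ , C⊆U w₁∈C , (λ w₁∈C₁ → proj₁ (proj₂ (C₁⁻ w₁∈C₁)) refl)
                                   , proj₁ (proj₂ (S₁⁻ s∈S₁)) , proj₁ (proj₂ (S₁⁻ t∈S₁)) }

      far : Far C₁ S₁
      far = z₁ , component-root (∈setOf⁺ D₁? (z₁∈C , (λ { refl → far-side refl }) , w₁≁z₁))
               , λ y∈S₁ z₁~y → far-side (two-step-side z₁~y (E-sym (proj₁ (proj₂ (S₁⁻ y∈S₁)))))

      smaller : ∣ C₁ ∣ < ∣ C ∣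
      smaller = shrinks (λ x∈C₁ → proj₁ (C₁⁻ x∈C₁)) w₁∈C (λ w₁∈C₁ → proj₁ (proj₂ (C₁⁻ w₁∈C₁)) refl)

      -- a neighbour of w in S would be an attachment of C₁
      result : Result U C₁ S₁ → Result U C S
      result (w , w∈C₁ , w-free , w-simplicial) =
        w , proj₁ (C₁⁻ w∈C₁) , (λ y∈S w~y → w-free (S₁⁺ (S⊆U y∈S) (dominates y∈S) w∈C₁ w~y) w~y) , w-simplicial

    module SeesFarSide {U C S w₁} (cl : Cluster U C S) (w₁∈C : w₁ ∈ C)
                       (sees : ∀ {x} → x ∈ C ⊎ x ∈ S → side x ≢ side w₁ → E w₁ x) where
      open Cluster cl

      U₁? : ∀ x → Dec (x ∈ U × x ≢ w₁)
      U₁? x = x ∈? U ×-dec ¬? (x ≟ᶠ w₁)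

      U₁ : Subset n
      U₁ = setOf U₁?

      toward-w₁ : ∀ {y} → y ∈ C → side y ≡ side w₁ → y ≼⟨ U ⟩ w₁
      toward-w₁ y∈C same x∈U y~x = sees (closed y∈C x∈U y~x) (λ eq → crossing y~x (trans same (sym eq)))

      lift : ∀ {a b} → (E a w₁ → E b w₁) → a ≼⟨ U₁ ⟩ b → a ≼⟨ U ⟩ b
      lift {a} {b} respects a≼₁b {x} x∈U a~x with x ≟ᶠ w₁
      ... | yes refl = respects a~x
      ... | no x≢w₁ = a≼₁b (∈setOf⁺ U₁? (x∈U , x≢w₁)) a~x

      neighbour-in-C : ∀ {w y} → w ∈ C → NoNeighbourIn S w → y ∈ U → E w y → y ∈ C
      neighbour-in-C w∈C w-free y∈U w~y with closed w∈C y∈U w~y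
      ... | inj₁ y∈C = y∈C
      ... | inj₂ y∈S = ⊥-elim (w-free y∈S w~y)

      seen : ∀ {w y} → w ∈ C → NoNeighbourIn S w → side w ≡ side w₁ → y ∈ U → E w y → E y w₁
      seen w∈C w-free w-side y∈U w~y =
        E-sym (sees (inj₁ (neighbour-in-C w∈C w-free y∈U w~y)) (λ eq → crossing w~y (trans w-side (sym eq))))

      near : ∀ {w y} → side w ≢ side w₁ → E w y → side y ≡ side w₁
      near w-side w~y = trans (¬-not (λ eq → crossing w~y (sym eq))) (sym (¬-not (λ eq → w-side (sym eq))))

      restore : ∀ {w} → w ∈ C → NoNeighbourIn S w → WeaklySimplicial U₁ w → WeaklySimplicial U w
      restore {w} w∈C w-free simplicial₁ {y₁} {y₂} y₁∈U y₂∈U w~y₁ w~y₂ with side w ≟ᵇ side w₁ | y₁ ≟ᶠ w₁ | y₂ ≟ᶠ w₁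
      ... | yes w-side | yes refl | _ = ⊥-elim (crossing w~y₁ w-side)
      ... | yes w-side | no _ | yes refl = ⊥-elim (crossing w~y₂ w-side)
      ... | no w-side | yes refl | _ =
        inj₂ (toward-w₁ (neighbour-in-C w∈C w-free y₂∈U w~y₂) (near w-side w~y₂))
      ... | no w-side | no _ | yes refl =
        inj₁ (toward-w₁ (neighbour-in-C w∈C w-free y₁∈U w~y₁) (near w-side w~y₁))
      ... | w-side? | no y₁≢w₁ | no y₂≢w₁ =
        Data.Sum.map (lift (respect w-side? y₂∈U w~y₂ w~y₁)) (lift (respect w-side? y₁∈U w~y₁ w~y₂))
          (simplicial₁ (∈setOf⁺ U₁? (y₁∈U , y₁≢w₁)) (∈setOf⁺ U₁? (y₂∈U , y₂≢w₁)) w~y₁ w~y₂)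
        where
        respect : ∀ {a b} → Dec (side w ≡ side w₁) → b ∈ U → E w b → E w a → E a w₁ → E b w₁
        respect (yes w-side) b∈U w~b _ _ = seen w∈C w-free w-side b∈U w~b
        respect (no w-side) _ _ w~a a~w₁ = ⊥-elim (same-side-¬E (near w-side w~a) a~w₁)

      module Remove {z} (z∈C : z ∈ C) (z≢w₁ : z ≢ w₁) (z-free : NoNeighbourIn S z) where
        D₂? : ∀ x → Dec (x ∈ C × x ≢ w₁)
        D₂? x = x ∈? C ×-dec ¬? (x ≟ᶠ w₁)

        C₂ : Subset n
        C₂ = component (setOf D₂?) z

        S₂? : ∀ y → Dec (y ∈ S × ∃ λ c → c ∈ C₂ × E c y)
        S₂? y = y ∈? S ×-dec any? (λ c → c ∈? C₂ ×-dec E? c y)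

        S₂ : Subset n
        S₂ = setOf S₂?

        C₂⁻ : ∀ {x} → x ∈ C₂ → x ∈ C × x ≢ w₁
        C₂⁻ = ∈setOf⁻ D₂? ∘ component-⊆

        S₂⁺ : ∀ {c y} → y ∈ S → c ∈ C₂ → E c y → y ∈ S₂
        S₂⁺ y∈S c∈C₂ c~y = ∈setOf⁺ S₂? (y∈S , _ , c∈C₂ , c~y)

        S₂⁻ : ∀ {y} → y ∈ S₂ → y ∈ S × ∃ λ c → c ∈ C₂ × E c y
        S₂⁻ = ∈setOf⁻ S₂?

        into-U₁ : ∀ {x} → x ∈ U → x ∉ C → x ∈ U₁
        into-U₁ x∈U x∉C = ∈setOf⁺ U₁? (x∈U , λ { refl → x∉C w₁∈C })

        closed₂ : ∀ {c y} → c ∈ C₂ → y ∈ U₁ → E c y → y ∈ C₂ ⊎ y ∈ S₂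
        closed₂ c∈C₂ y∈U₁ c~y with ∈setOf⁻ U₁? y∈U₁
        ... | y∈U , y≢w₁ with closed (proj₁ (C₂⁻ c∈C₂)) y∈U c~y
        ...   | inj₁ y∈C = inj₁ (component-closed c∈C₂ (∈setOf⁺ D₂? (y∈C , y≢w₁)) c~y)
        ...   | inj₂ y∈S = inj₂ (S₂⁺ y∈S c∈C₂ c~y)

        cluster : Cluster U₁ C₂ S₂
        cluster = record
          { C⊆U = λ x∈C₂ → ∈setOf⁺ U₁? (C⊆U (proj₁ (C₂⁻ x∈C₂)) , proj₂ (C₂⁻ x∈C₂))
          ; S⊆U = λ y∈S₂ → into-U₁ (S⊆U (proj₁ (S₂⁻ y∈S₂))) (λ y∈C → disjoint y∈C (proj₁ (S₂⁻ y∈S₂)))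
          ; disjoint = λ x∈C₂ x∈S₂ → disjoint (proj₁ (C₂⁻ x∈C₂)) (proj₁ (S₂⁻ x∈S₂))
          ; connected = component-connected
          ; closed = closed₂
          ; attached = λ s∈S₂ → let (c , c∈C₂ , c~s) = proj₂ (S₂⁻ s∈S₂) in c , c∈C₂ , E-sym c~s
          ; linked = λ s∈S₂ t∈S₂ s≢t → let (v , v∈U , v∉C , v~s , v~t) = linked (proj₁ (S₂⁻ s∈S₂)) (proj₁ (S₂⁻ t∈S₂)) s≢t
                                        in v , into-U₁ v∈U v∉C , v∉C ∘ proj₁ ∘ C₂⁻ , v~s , v~t }

        far : Far C₂ S₂
        far = z , component-root (∈setOf⁺ D₂? (z∈C , z≢w₁)) , z-free ∘ proj₁ ∘ S₂⁻

        smaller : ∣ C₂ ∣ < ∣ C ∣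
        smaller = shrinks (λ x∈C₂ → proj₁ (C₂⁻ x∈C₂)) w₁∈C (λ w₁∈C₂ → proj₂ (C₂⁻ w₁∈C₂) refl)

        result : Result U₁ C₂ S₂ → Result U C S
        result (w , w∈C₂ , w-free , w-simplicial) =
          w , proj₁ (C₂⁻ w∈C₂) , w-free′ , restore (proj₁ (C₂⁻ w∈C₂)) w-free′ w-simplicial
          where
          w-free′ : NoNeighbourIn S w
          w-free′ y∈S w~y = w-free (S₂⁺ y∈S w∈C₂ w~y) w~y

    split-off-far-side : ∀ {U C S w₁ z₁} → Smaller ∣ C ∣ → Cluster U C S → w₁ ∈ C →
      (∀ {s} → s ∈ S → E w₁ s) → z₁ ∈ C → side z₁ ≢ side w₁ → ¬ E w₁ z₁ → Result U C S
    split-off-far-side recurse cl w₁∈C dominates z₁∈C far-side w₁≁z₁ = result (recurse smaller cluster far)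
      where open SplitOff cl w₁∈C dominates z₁∈C far-side w₁≁z₁

    remove-dominating : ∀ {U C S w₁ z} → Smaller ∣ C ∣ → Cluster U C S → w₁ ∈ C →
      (∀ {x} → x ∈ C ⊎ x ∈ S → side x ≢ side w₁ → E w₁ x) →
      z ∈ C → z ≢ w₁ → NoNeighbourIn S z → Result U C S
    remove-dominating recurse cl w₁∈C sees z∈C z≢w₁ z-free = result (recurse smaller cluster far)
      where open SeesFarSide.Remove cl w₁∈C sees z∈C z≢w₁ z-free

    -- Case B2: some vertex of C has no neighbour in S, but w₁, adjacent to
    -- every attachment, is the only one.  Then S is empty and any U-neighbour
    -- of w₁ would be another such vertex, so w₁ is isolated in U.
    isolated-dominating : ∀ {U C S w₁} → Cluster U C S → w₁ ∈ C → (∀ {s} → s ∈ S → E w₁ s) →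
      Far C S → (∀ {z} → z ∈ C → z ≢ w₁ → ¬ NoNeighbourIn S z) → Result U C S
    isolated-dominating {U} {C} {S} {w₁} cl w₁∈C dominates (z , z∈C , z-free) only =
      w₁ , w₁∈C , (λ s∈S _ → S-empty s∈S) , λ y₁∈U _ w₁~y₁ _ → ⊥-elim (isolated y₁∈U w₁~y₁)
      where
      open Cluster cl
      S-empty : ∀ {s} → s ∉ S
      S-empty s∈S with z ≟ᶠ w₁
      ... | yes refl = z-free s∈S (dominates s∈S)
      ... | no z≢w₁ = only z∈C z≢w₁ z-free
      isolated : ∀ {y} → y ∈ U → ¬ E w₁ y
      isolated y∈U w₁~y with closed w₁∈C y∈U w₁~y
      ... | inj₂ y∈S = S-empty y∈S
      ... | inj₁ y∈C = only y∈C (λ { refl → E-irrefl w₁~y }) (λ y∈S → ⊥-elim (S-empty y∈S))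

    sees-far-side : ∀ {C S w₁} → (∀ {s} → s ∈ S → E w₁ s) →
      ¬ (∃ λ x → x ∈ C × side x ≢ side w₁ × ¬ E w₁ x) →
      ∀ {x} → x ∈ C ⊎ x ∈ S → side x ≢ side w₁ → E w₁ x
    sees-far-side dominates _ (inj₂ x∈S) _ = dominates x∈S
    sees-far-side {w₁ = w₁} _ unseen {x} (inj₁ x∈C) far-side with E? w₁ x
    ... | yes w₁~x = w₁~x
    ... | no w₁≁x = ⊥-elim (unseen (x , x∈C , far-side , w₁≁x))

    -- Every cluster with a vertex avoiding its attachments contains such a
    -- vertex that is weakly simplicial in U; by induction on |C|, choosing
    -- w₁ ∈ C adjacent to all attachments and splitting into the cases above.
    weakly-simplicial-below : ∀ {U C S} → Acc _<_ ∣ C ∣ → Cluster U C S → Far C S → Result U C S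
    weakly-simplicial-below {U} {C} {S} (acc smaller) cl far
      with dominating-vertex cl (proj₁ far , proj₁ (proj₂ far))
    ... | w₁ , w₁∈C , dominates
      with any? (λ x → x ∈? C ×-dec ¬? (side x ≟ᵇ side w₁) ×-dec ¬? (E? w₁ x))
    ... | yes (z₁ , z₁∈C , far-side , w₁≁z₁) =
      split-off-far-side (λ lt → weakly-simplicial-below (smaller lt)) cl w₁∈C dominates z₁∈C far-side w₁≁z₁
    ... | no unseen
      with any? (λ z → z ∈? C ×-dec ¬? (z ≟ᶠ w₁) ×-dec all? (λ y → y ∈? S →-dec ¬? (E? z y)))
    ...   | yes (z , z∈C , z≢w₁ , z-free) =
      remove-dominating (λ lt → weakly-simplicial-below (smaller lt)) cl w₁∈C
        (sees-far-side dominates unseen) z∈C z≢w₁ (λ {y} → z-free y)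
    ...   | no none = isolated-dominating cl w₁∈C dominates far
                        (λ z∈C z≢w₁ z-free → none (_ , z∈C , z≢w₁ , λ _ → z-free))

    whole : ∀ v₀ → Cluster full (component full v₀) ∅
    whole v₀ = record
      { C⊆U = λ _ → ∈⊤ ; S⊆U = ⊥-elim ∘ ∉⊥ ; disjoint = λ _ → ∉⊥
      ; connected = component-connected
      ; closed = λ c∈C _ c~y → inj₁ (component-closed c∈C ∈⊤ c~y)
      ; attached = ⊥-elim ∘ ∉⊥ ; linked = λ s∈∅ → ⊥-elim (∉⊥ s∈∅) }

    -- A chordal bipartite graph with a vertex has an isolated vertex or a
    -- bisimplicial edge: take a weakly simplicial vertex w and its neighbour
    -- q with minimal neighbourhood.
    isolated-or-bisimplicial : Fin n → (∃ λ w → ∀ y → ¬ E w y) ⊎ (∃ λ p → ∃ λ q → Bisimplicial p q)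
    isolated-or-bisimplicial v₀
      with weakly-simplicial-below (<-wellFounded _) (whole v₀) (v₀ , component-root ∈⊤ , ⊥-elim ∘ ∉⊥)
    ... | w , _ , _ , simplicial with any? (E? w)
    ...   | no isolated = inj₁ (w , λ y w~y → isolated (y , w~y))
    ...   | yes (_ , w~y₀) with minimal-neighbour w~y₀
    ...     | q , w~q , minimal = inj₂ (w , q , w~q , bisimplicial)
      where
      bisimplicial : ∀ {k k′} → E w k → E q k′ → E k k′
      bisimplicial w~k q~k′ with simplicial ∈⊤ ∈⊤ w~q w~k
      ... | inj₁ q≼k = q≼k ∈⊤ q~k′
      ... | inj₂ k≼q = minimal w~k (k≼q ∈⊤) q~k′

1-odd : Odd 1
1-odd = toWitnessFalse {a? = 2 ∣? 1} tt

3-odd : Odd 3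
3-odd = toWitnessFalse {a? = 2 ∣? 3} tt

ordered₄ : ∀ {p} {P : Fin 4 → Fin 4 → Set p} →
  P zero (suc zero) → P zero (suc (suc zero)) → P zero (suc (suc (suc zero))) →
  P (suc zero) (suc (suc zero)) → P (suc zero) (suc (suc (suc zero))) →
  P (suc (suc zero)) (suc (suc (suc zero))) → ∀ {i j} → i <ᶠ j → P i j
ordered₄ p01 _ _ _ _ _ {zero} {suc zero} _ = p01
ordered₄ _ p02 _ _ _ _ {zero} {suc (suc zero)} _ = p02
ordered₄ _ _ p03 _ _ _ {zero} {suc (suc (suc zero))} _ = p03
ordered₄ _ _ _ p12 _ _ {suc zero} {suc (suc zero)} _ = p12
ordered₄ _ _ _ _ p13 _ {suc zero} {suc (suc (suc zero))} _ = p13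
ordered₄ _ _ _ _ _ p23 {suc (suc zero)} {suc (suc (suc zero))} _ = p23
ordered₄ _ _ _ _ _ _ {_} {zero} ()
ordered₄ _ _ _ _ _ _ {suc _} {suc zero} (s≤s ())
ordered₄ _ _ _ _ _ _ {suc (suc _)} {suc (suc zero)} (s≤s (s≤s ()))
ordered₄ _ _ _ _ _ _ {suc (suc (suc _))} {suc (suc (suc zero))} (s≤s (s≤s (s≤s ())))

module Induced (G : Graph) where
  open Graph G using (irrefl)

  private
    Adj′ : V G → V G → Set
    Adj′ = Adj G

  edge⇔ : ∀ {x y} {R : Set} → Adj′ x y → R → Adj′ x y ⇔ R
  edge⇔ x~y r = mk⇔ (λ _ → r) (λ _ → x~y)

  non-edge⇔ : ∀ {x y} {R : Set} → ¬ Adj′ x y → ¬ R → Adj′ x y ⇔ R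
  non-edge⇔ x≁y ¬r = mk⇔ (⊥-elim ∘ x≁y) (⊥-elim ∘ ¬r)

  module _ {k} (v : Fin k → V G) where

    injective : (∀ {i j} → i <ᶠ j → v i ≢ v j) → Injective _≡_ _≡_ v
    injective separated {i} {j} eq with <ᶠ-cmp i j
    ... | tri< i<j _ _ = ⊥-elim (separated i<j eq)
    ... | tri≈ _ i≡j _ = i≡j
    ... | tri> _ _ j<i = ⊥-elim (separated j<i (sym eq))

    adjacency : (R : Fin k → Fin k → Set) → (∀ {i j} → R i j → R j i) → (∀ {i} → ¬ R i i) →
      (∀ {i j} → i <ᶠ j → Adj′ (v i) (v j) ⇔ R i j) → ∀ i j → Adj′ (v i) (v j) ⇔ R i j
    adjacency R R-sym R-irrefl ordered i j with <ᶠ-cmp i j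
    ... | tri< i<j _ _ = ordered i<j
    ... | tri≈ _ refl _ = non-edge⇔ (irrefl (v i)) R-irrefl
    ... | tri> _ _ j<i = mk⇔ (R-sym ∘ Equivalence.to (ordered j<i) ∘ Graph.sym G _ _)
                             (Graph.sym G _ _ ∘ Equivalence.from (ordered j<i) ∘ R-sym)

  Consecutive : ∀ {k} → Fin k → Fin k → Set
  Consecutive i j = (suc (toℕ i) ≡ toℕ j) ⊎ (suc (toℕ j) ≡ toℕ i)

  consecutive-irrefl : ∀ {k} {i : Fin k} → ¬ Consecutive i i
  consecutive-irrefl (inj₁ next) = 1+n≢n next
  consecutive-irrefl (inj₂ next) = 1+n≢n next

  cyc-irrefl : ∀ {k} {i : Fin (suc (suc k))} → ¬ CycAdj (suc (suc k)) i i
  cyc-irrefl {k} {i} = [ next-irrefl , next-irrefl ]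
    where
    next-irrefl : ¬ CycNext (suc (suc k)) i i
    next-irrefl (inj₁ next) = 1+n≢n next
    next-irrefl (inj₂ (wraps , at-0)) with toℕ i
    next-irrefl (inj₂ (() , refl)) | zero

  path₀ : V G → Path G
  path₀ a = record { len = 0 ; vtx = λ _ → a ; inj = λ { {zero} {zero} _ → refl }
                   ; adjIff = λ { zero zero → non-edge⇔ (irrefl a) (consecutive-irrefl {k = 1} {i = zero}) } }

  path₁ : ∀ {a b} → Adj′ a b → Path G
  path₁ {a} {b} a~b = record { len = 1 ; vtx = vtx ; inj = injective vtx separated
                             ; adjIff = adjacency vtx Consecutive swap consecutive-irrefl ordered }
    where
    vtx : Fin 2 → V G
    vtx zero = a
    vtx (suc zero) = b
    separated : ∀ {i j} → i <ᶠ j → vtx i ≢ vtx j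
    separated {zero} {suc zero} _ refl = irrefl a a~b
    separated {suc _} {suc zero} (s≤s ())
    ordered : ∀ {i j} → i <ᶠ j → Adj′ (vtx i) (vtx j) ⇔ Consecutive i j
    ordered {zero} {suc zero} _ = edge⇔ a~b (inj₁ refl)
    ordered {suc _} {suc zero} (s≤s ())

  module _ (p₀ p₁ p₂ p₃ : V G)
           (d01 : p₀ ≢ p₁) (d02 : p₀ ≢ p₂) (d03 : p₀ ≢ p₃) (d12 : p₁ ≢ p₂) (d13 : p₁ ≢ p₃) (d23 : p₂ ≢ p₃) where

    vtx₄ : Fin 4 → V G
    vtx₄ zero = p₀
    vtx₄ (suc zero) = p₁
    vtx₄ (suc (suc zero)) = p₂
    vtx₄ (suc (suc (suc zero))) = p₃

    inj₄ : Injective _≡_ _≡_ vtx₄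
    inj₄ = injective vtx₄ (ordered₄ {P = λ i j → vtx₄ i ≢ vtx₄ j} d01 d02 d03 d12 d13 d23)

    path₃ : Adj′ p₀ p₁ → Adj′ p₁ p₂ → Adj′ p₂ p₃ → ¬ Adj′ p₀ p₂ → ¬ Adj′ p₀ p₃ → ¬ Adj′ p₁ p₃ → Path G
    path₃ a01 a12 a23 n02 n03 n13 = record
      { len = 3 ; vtx = vtx₄ ; inj = inj₄
      ; adjIff = adjacency vtx₄ Consecutive swap consecutive-irrefl
          (ordered₄ {P = λ i j → Adj′ (vtx₄ i) (vtx₄ j) ⇔ Consecutive i j}
            (edge⇔ a01 (inj₁ refl)) (non-edge⇔ n02 λ { (inj₁ ()) ; (inj₂ ()) }) (non-edge⇔ n03 λ { (inj₁ ()) ; (inj₂ ()) })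
            (edge⇔ a12 (inj₁ refl)) (non-edge⇔ n13 λ { (inj₁ ()) ; (inj₂ ()) }) (edge⇔ a23 (inj₁ refl))) }

    hole₄ : Adj′ p₀ p₁ → Adj′ p₁ p₂ → Adj′ p₂ p₃ → Adj′ p₀ p₃ → ¬ Adj′ p₀ p₂ → ¬ Adj′ p₁ p₃ → Hole G
    hole₄ a01 a12 a23 a03 n02 n13 = record
      { len = 4 ; len≥4 = s≤s (s≤s (s≤s (s≤s z≤n))) ; vtx = vtx₄ ; inj = inj₄
      ; adjIff = adjacency vtx₄ (CycAdj 4) swap cyc-irrefl
          (ordered₄ {P = λ i j → Adj′ (vtx₄ i) (vtx₄ j) ⇔ CycAdj 4 i j}
            (edge⇔ a01 (inj₁ (inj₁ refl)))
            (non-edge⇔ n02 λ { (inj₁ (inj₁ ())) ; (inj₁ (inj₂ (() , _))) ; (inj₂ (inj₁ ())) ; (inj₂ (inj₂ (() , _))) })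
            (edge⇔ a03 (inj₂ (inj₂ (refl , refl))))
            (edge⇔ a12 (inj₁ (inj₁ refl)))
            (non-edge⇔ n13 λ { (inj₁ (inj₁ ())) ; (inj₁ (inj₂ (() , _))) ; (inj₂ (inj₁ ())) ; (inj₂ (inj₂ (_ , ()))) })
            (edge⇔ a23 (inj₁ (inj₁ refl)))) }

module Cobipartite (G : Graph) (A : Subset (Graph.n G)) (cobipartite : IsCobipartite G A) where
  open Graph G using (n; adj; irrefl)
  open Induced G

  side : V G → Bool
  side x = lookup A x

  side-clique : V G → Subset n
  side-clique x = if side x then A else ∁ A

  in-side-clique : ∀ x → x ∈ side-clique x
  in-side-clique x with side x in eq
  ... | true = lookup⇒[]= x A eq
  ... | false = x∉p⇒x∈∁p (λ x∈A → case-false (trans (sym eq) ([]=⇒lookup x∈A)))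
    where
    case-false : false ≢ true
    case-false ()

  side-clique-clique : ∀ x → IsClique G (side-clique x)
  side-clique-clique x with side x
  ... | true = proj₁ cobipartite
  ... | false = proj₂ cobipartite

  same-side-adjacent : ∀ {u v} → u ≢ v → side u ≡ side v → Adj G u v
  same-side-adjacent {u} {v} u≢v same =
    side-clique-clique u u v (in-side-clique u)
      (subst (λ b → v ∈ (if b then A else ∁ A)) (sym same) (in-side-clique v)) u≢v

  -- u ∼ v: u and v lie on different sides and are non-adjacent in G; these are
  -- the edges of the bipartite complement of G
  _∼_ : V G → V G → Set
  u ∼ v = side u ≢ side v × ¬ Adj G u v

  _∼?_ : ∀ u v → Dec (u ∼ v)
  u ∼? v = ¬? (side u ≟ᵇ side v) ×-dec ¬? (T? (adj u v))

  ∼-sym : ∀ {u v} → u ∼ v → v ∼ u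
  ∼-sym (sides , u≁v) = sides ∘ sym , u≁v ∘ Graph.sym G _ _

  ∼-irrefl : ∀ {u} → ¬ u ∼ u
  ∼-irrefl (sides , _) = sides refl

  ∼⇒≢ : ∀ {u v} → u ∼ v → u ≢ v
  ∼⇒≢ u∼v refl = ∼-irrefl u∼v

  adjacent-unless-∼ : ∀ {u v} → u ≢ v → ¬ u ∼ v → Adj G u v
  adjacent-unless-∼ {u} {v} u≢v u≁v with side u ≟ᵇ side v | T? (adj u v)
  ... | yes same | _ = same-side-adjacent u≢v same
  ... | no _ | yes u~v = u~v
  ... | no sides | no u≁ᴳv = ⊥-elim (u≁v (sides , u≁ᴳv))

  open Bipartite _∼_ _∼?_ ∼-sym ∼-irrefl side proj₁

  antihole : LongHole → Antihole G
  antihole H = record { len = suc m ; len≥6 = s≤s 5≤m ; vtx = g ∘ toℕ ; inj = inj ; adjIff = adj-iff }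
    where
    open LongHole H
    bound : ∀ (i : Fin (suc m)) → toℕ i ≤ m
    bound i = ≤-pred (toℕ<n i)
    inj : ∀ {i j : Fin (suc m)} → g (toℕ i) ≡ g (toℕ j) → i ≡ j
    inj {i} {j} eq = toℕ-injective (distinct (toℕ i) (toℕ j) (bound i) (bound j) eq)
    cycle⇒∼ : ∀ i j → CycAdj (suc m) i j → g (toℕ i) ∼ g (toℕ j)
    cycle⇒∼ i j (inj₁ (inj₁ next)) rewrite sym next = edge (toℕ i) (subst (_≤ m) (sym next) (bound j))
    cycle⇒∼ i j (inj₁ (inj₂ (last , first))) rewrite suc-injective last | first = wrap
    cycle⇒∼ i j (inj₂ (inj₁ next)) rewrite sym next = ∼-sym (edge (toℕ j) (subst (_≤ m) (sym next) (bound i)))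
    cycle⇒∼ i j (inj₂ (inj₂ (last , first))) rewrite suc-injective last | first = ∼-sym wrap
    ∼⇒cycle : ∀ i j → g (toℕ i) ∼ g (toℕ j) → CycAdj (suc m) i j
    ∼⇒cycle i j e with chordless (toℕ i) (toℕ j) (bound i) (bound j) e
    ... | inj₁ next = inj₁ (inj₁ next)
    ... | inj₂ (inj₁ next) = inj₂ (inj₁ next)
    ... | inj₂ (inj₂ (inj₁ (first , last))) = inj₂ (inj₂ (cong suc last , first))
    ... | inj₂ (inj₂ (inj₂ (first , last))) = inj₁ (inj₂ (cong suc last , first))
    adj-iff : ∀ i j → Adj G (g (toℕ i)) (g (toℕ j)) ⇔ ((i ≢ j) × ¬ CycAdj (suc m) i j)
    adj-iff i j = mk⇔ (λ a → (λ { refl → irrefl _ a }) , (λ c → proj₂ (cycle⇒∼ i j c) a))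
                      (λ { (i≢j , ¬c) → adjacent-unless-∼ (i≢j ∘ inj) (¬c ∘ ∼⇒cycle i j) })

  -- A vertex outside a maximal clique K is joined in the complement to some
  -- vertex of K: otherwise it could be added to K.
  escape : ∀ {K p} → IsMaximalClique G K → p ∉ K → ∃ λ k → k ∈ K × p ∼ k
  escape {K} {p} (clique , _ , maximal) p∉K with any? (λ k → k ∈? K ×-dec p ∼? k)
  ... | yes found = found
  ... | no none = ⊥-elim (p∉K (maximal (K ∪ ⁅ p ⁆) extended (λ x∈K → x∈p∪q⁺ (inj₁ x∈K)) (x∈p∪q⁺ (inj₂ (x∈⁅x⁆ p)))))
    where
    extended : IsClique G (K ∪ ⁅ p ⁆)
    extended u v u∈ v∈ u≢v with x∈p∪q⁻ K ⁅ p ⁆ u∈ | x∈p∪q⁻ K ⁅ p ⁆ v∈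
    ... | inj₁ u∈K | inj₁ v∈K = clique u v u∈K v∈K u≢v
    ... | inj₁ u∈K | inj₂ v∈p rewrite x∈⁅y⁆⇒x≡y p v∈p = adjacent-unless-∼ u≢v (λ u∼p → none (u , u∈K , ∼-sym u∼p))
    ... | inj₂ u∈p | inj₁ v∈K rewrite x∈⁅y⁆⇒x≡y p u∈p = adjacent-unless-∼ u≢v (λ p∼v → none (v , v∈K , p∼v))
    ... | inj₂ u∈p | inj₂ v∈p = ⊥-elim (u≢v (trans (x∈⁅y⁆⇒x≡y p u∈p) (sym (x∈⁅y⁆⇒x≡y p v∈p))))

  strong-isolated : ∀ {p} → (∀ y → ¬ p ∼ y) → IsStrongStable G ⁅ p ⁆
  strong-isolated {p} isolated = stable , meets
    where
    stable : IsStable G ⁅ p ⁆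
    stable u v u∈ v∈ rewrite x∈⁅y⁆⇒x≡y p u∈ | x∈⁅y⁆⇒x≡y p v∈ = irrefl p
    meets : ∀ K → IsMaximalClique G K → ∃ λ v → v ∈ K × v ∈ ⁅ p ⁆
    meets K maximal with p ∈? K
    ... | yes p∈K = p , p∈K , x∈⁅x⁆ p
    ... | no p∉K = ⊥-elim (isolated _ (proj₂ (proj₂ (escape maximal p∉K))))

  -- The ends of a bisimplicial edge of the complement form a strong stable
  -- set: a maximal clique missing both would contain neighbours k of p and
  -- k′ of q, which are joined in the complement.
  strong-bisimplicial : ∀ {p q} → Bisimplicial p q → IsStrongStable G (⁅ p ⁆ ∪ ⁅ q ⁆)
  strong-bisimplicial {p} {q} (p∼q , joined) = stable , meets
    where
    members : ∀ {x} → x ∈ ⁅ p ⁆ ∪ ⁅ q ⁆ → x ≡ p ⊎ x ≡ q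
    members x∈ with x∈p∪q⁻ ⁅ p ⁆ ⁅ q ⁆ x∈
    ... | inj₁ x∈p = inj₁ (x∈⁅y⁆⇒x≡y p x∈p)
    ... | inj₂ x∈q = inj₂ (x∈⁅y⁆⇒x≡y q x∈q)
    stable : IsStable G (⁅ p ⁆ ∪ ⁅ q ⁆)
    stable u v u∈ v∈ with members u∈ | members v∈
    ... | inj₁ refl | inj₁ refl = irrefl u
    ... | inj₁ refl | inj₂ refl = proj₂ p∼q
    ... | inj₂ refl | inj₁ refl = proj₂ (∼-sym p∼q)
    ... | inj₂ refl | inj₂ refl = irrefl u
    meets : ∀ K → IsMaximalClique G K → ∃ λ v → v ∈ K × v ∈ ⁅ p ⁆ ∪ ⁅ q ⁆
    meets K maximal with p ∈? K | q ∈? K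
    ... | yes p∈K | _ = p , p∈K , x∈p∪q⁺ (inj₁ (x∈⁅x⁆ p))
    ... | no _ | yes q∈K = q , q∈K , x∈p∪q⁺ (inj₂ (x∈⁅x⁆ q))
    ... | no p∉K | no q∉K with escape maximal p∉K | escape maximal q∉K
    ...   | k , k∈K , p∼k | k′ , k′∈K , q∼k′ =
      ⊥-elim (proj₂ (joined p∼k q∼k′) (proj₁ maximal k k′ k∈K k′∈K (∼⇒≢ (joined p∼k q∼k′))))

  strong-through : ∀ {p} → (∀ y → ¬ p ∼ y) ⊎ ∃ (Bisimplicial p) →
    Σ (Subset n) λ S → IsStrongStable G S × p ∈ S
  strong-through {p} (inj₁ isolated) = ⁅ p ⁆ , strong-isolated isolated , x∈⁅x⁆ p
  strong-through {p} (inj₂ (q , bisimplicial)) =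
    ⁅ p ⁆ ∪ ⁅ q ⁆ , strong-bisimplicial bisimplicial , x∈p∪q⁺ (inj₁ (x∈⁅x⁆ p))

  vertex-or-empty : ∀ k → Fin k ⊎ ¬ Fin k
  vertex-or-empty zero = inj₂ λ ()
  vertex-or-empty (suc k) = inj₁ zero

  -- Without antiholes of length at least six, the complement is chordal
  -- bipartite and so G has a strong stable set.
  strong-stable-set : ¬ Antihole G → Σ (Subset n) (IsStrongStable G)
  strong-stable-set no-antihole with vertex-or-empty n
  ... | inj₂ empty = ∅ , (λ u → ⊥-elim (empty u)) , λ _ (_ , (v , _) , _) → ⊥-elim (empty v)
  ... | inj₁ v₀ with Chordal.isolated-or-bisimplicial (no-antihole ∘ antihole) v₀
  ...   | inj₁ (w , isolated) = ⁅ w ⁆ , strong-isolated isolated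
  ...   | inj₂ (p , q , bisimplicial) = ⁅ p ⁆ ∪ ⁅ q ⁆ , strong-bisimplicial bisimplicial

  -- Two distinct vertices of a consistent set are non-adjacent, since an
  -- edge is a path of odd length …
  consistent-nonadjacent : ∀ {Z u v} → IsConsistent G Z → u ∈ Z → v ∈ Z → u ≢ v → ¬ Adj G u v
  consistent-nonadjacent consistent u∈Z v∈Z u≢v u~v =
    1-odd (consistent _ _ u∈Z v∈Z u≢v (path₁ u~v) refl refl)

  consistent-one-per-side : ∀ {Z u v} → IsConsistent G Z → u ∈ Z → v ∈ Z → side u ≡ side v → u ≡ v
  consistent-one-per-side {u = u} {v} consistent u∈Z v∈Z same with u ≟ᶠ v
  ... | yes u≡v = u≡v
  ... | no u≢v = ⊥-elim (consistent-nonadjacent consistent u∈Z v∈Z u≢v (same-side-adjacent u≢v same))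

  -- An edge a ∼ b of the complement whose ends form an even pair is
  -- bisimplicial: otherwise a - k′ - k - b would be an induced path of
  -- length three in G.
  even-pair-bisimplicial : ∀ {a b} → a ∼ b → IsEvenPair G a b → Bisimplicial a b
  even-pair-bisimplicial {a} {b} a∼b even = a∼b , joined
    where
    joined : ∀ {k k′} → a ∼ k → b ∼ k′ → k ∼ k′
    joined {k} {k′} a∼k b∼k′ with k ∼? k′ | k ≟ᶠ b | k′ ≟ᶠ a
    ... | yes k∼k′ | _ | _ = k∼k′
    ... | no _ | yes refl | _ = b∼k′
    ... | no _ | no _ | yes refl = ∼-sym a∼k
    ... | no k≁k′ | no k≢b | no k′≢a = ⊥-elim (3-odd (even P refl refl))
      where
      a-side : side a ≡ side k′
      a-side = two-step-side a∼b b∼k′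
      b-side : side k ≡ side b
      b-side = two-step-side (∼-sym a∼k) a∼b
      k′≢k : k′ ≢ k
      k′≢k refl = proj₁ a∼b (trans a-side b-side)
      P : Path G
      P = path₃ a k′ k b (k′≢a ∘ sym) (∼⇒≢ a∼k) (∼⇒≢ a∼b) k′≢k (∼⇒≢ (∼-sym b∼k′)) k≢b
            (same-side-adjacent (k′≢a ∘ sym) a-side) (adjacent-unless-∼ k′≢k (k≁k′ ∘ ∼-sym))
            (same-side-adjacent k≢b b-side) (proj₂ a∼k) (proj₂ a∼b) (proj₂ (∼-sym b∼k′))

  -- A safe vertex a has no clown: if a ∼ q, a ∼ k, q ∼ k′ and k ∼ k″ while
  -- k ≁ k′, q ≁ k″ and k′ ≠ a, then k′ - k″ - q - k - k′ is a hole of G of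
  -- length four with hat a, and the one-vertex path at a has even length.
  clown-free : ∀ {a q k k′ k″} → IsSafe G a → a ∼ q → a ∼ k → q ∼ k′ → k ∼ k″ →
    ¬ k ∼ k′ → ¬ q ∼ k″ → k′ ≢ a → ⊥
  clown-free {a} {q} {k} {k′} {k″} safe a∼q a∼k q∼k′ k∼k″ k≁k′ q≁k″ k′≢a =
    proj₂ safe clown (path₀ a) refl refl (λ _ (_ , a≡x) x≢a → ⊥-elim (x≢a (sym a≡x))) (divides 0 refl)
    where
    k′-side : side a ≡ side k′
    k′-side = two-step-side a∼q q∼k′
    k″-side : side a ≡ side k″
    k″-side = two-step-side a∼k k∼k″
    q-side : side q ≡ side k
    q-side = two-step-side (∼-sym a∼q) a∼k
    k″≢a : k″ ≢ a
    k″≢a refl = q≁k″ (∼-sym a∼q)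
    k′≢k″ : k′ ≢ k″
    k′≢k″ refl = k≁k′ k∼k″
    k′≢k : k′ ≢ k
    k′≢k refl = proj₁ a∼k k′-side
    k″≢q : k″ ≢ q
    k″≢q refl = proj₁ a∼q k″-side
    q≢k : q ≢ k
    q≢k refl = k≁k′ q∼k′
    C : Hole G
    C = hole₄ k′ k″ q k k′≢k″ (∼⇒≢ (∼-sym q∼k′)) k′≢k k″≢q (∼⇒≢ (∼-sym k∼k″)) q≢k
          (same-side-adjacent k′≢k″ (trans (sym k′-side) k″-side))
          (adjacent-unless-∼ k″≢q (q≁k″ ∘ ∼-sym))
          (same-side-adjacent q≢k q-side)
          (adjacent-unless-∼ k′≢k (k≁k′ ∘ ∼-sym))
          (proj₂ (∼-sym q∼k′)) (proj₂ (∼-sym k∼k″))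
    clown : Clown G
    clown = record
      { C = C ; evenC = divides 2 refl ; hat = a
      ; hat∉ = λ { (zero , k′≡a) → k′≢a k′≡a ; (suc zero , k″≡a) → k″≢a k″≡a
                 ; (suc (suc zero) , refl) → ∼-irrefl a∼q ; (suc (suc (suc zero)) , refl) → ∼-irrefl a∼k }
      ; hatAdj = λ { zero → edge⇔ (same-side-adjacent (k′≢a ∘ sym) k′-side) (inj₁ refl)
                   ; (suc zero) → edge⇔ (same-side-adjacent (k″≢a ∘ sym) k″-side) (inj₂ refl)
                   ; (suc (suc zero)) → non-edge⇔ (proj₂ a∼q) λ { (inj₁ ()) ; (inj₂ ()) }
                   ; (suc (suc (suc zero))) → non-edge⇔ (proj₂ a∼k) λ { (inj₁ ()) ; (inj₂ ()) } } }

  -- A safe vertex is isolated in the complement or the end of a bisimplicial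
  -- edge, namely the one to its neighbour with minimal neighbourhood.
  safe-bisimplicial : ∀ {a} → IsSafe G a → (∀ y → ¬ a ∼ y) ⊎ ∃ (Bisimplicial a)
  safe-bisimplicial {a} safe with any? (a ∼?_)
  ... | no isolated = inj₁ λ y a∼y → isolated (y , a∼y)
  ... | yes (_ , a∼q₀) with minimal-neighbour a∼q₀
  ...   | q , a∼q , minimal = inj₂ (q , a∼q , joined)
    where
    joined : ∀ {k k′} → a ∼ k → q ∼ k′ → k ∼ k′
    joined {k} {k′} a∼k q∼k′ with k ∼? k′ | k′ ≟ᶠ a
    ... | yes k∼k′ | _ = k∼k′
    ... | no _ | yes refl = ∼-sym a∼k
    ... | no k≁k′ | no k′≢a with any? (λ x → k ∼? x ×-dec ¬? (q ∼? x))
    ...   | yes (k″ , k∼k″ , q≁k″) = ⊥-elim (clown-free safe a∼q a∼k q∼k′ k∼k″ k≁k′ q≁k″ k′≢a)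
    ...   | no none = minimal a∼k k≼q q∼k′
      where
      k≼q : ∀ {x} → k ∼ x → q ∼ x
      k≼q {x} k∼x with q ∼? x
      ... | yes q∼x = q∼x
      ... | no q≁x = ⊥-elim (none (x , k∼x , q≁x))

  consistent-∼ : ∀ {Z a b} → IsConsistent G Z → a ∈ Z → b ∈ Z → side a ≢ side b → a ∼ b
  consistent-∼ consistent a∈Z b∈Z sides =
    sides , consistent-nonadjacent consistent a∈Z b∈Z (λ { refl → sides refl })

  consistent-⊆-pair : ∀ {Z a b} → IsConsistent G Z → a ∈ Z → b ∈ Z → side a ≢ side b →
    Z ⊆ ⁅ a ⁆ ∪ ⁅ b ⁆
  consistent-⊆-pair {a = a} {b} consistent a∈Z b∈Z sides {z} z∈Z with side z ≟ᵇ side a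
  ... | yes z-side = x∈p∪q⁺ (inj₁ (subst (_∈ ⁅ a ⁆) (sym (consistent-one-per-side consistent z∈Z a∈Z z-side)) (x∈⁅x⁆ a)))
  ... | no z-side = x∈p∪q⁺ (inj₂ (subst (_∈ ⁅ b ⁆) (sym (consistent-one-per-side consistent z∈Z b∈Z b-side)) (x∈⁅x⁆ b)))
    where
    b-side : side z ≡ side b
    b-side = trans (¬-not z-side) (sym (¬-not (sides ∘ sym)))

  -- With a vertex of Z on each side, those two form a bisimplicial edge;
  -- with vertices on one side only, Z is a single safe vertex; with none, any
  -- strong stable set will do.
  strong-stable-set-containing : Innocent G → (Z : Subset n) → IsConsistent G Z →
    (∀ v → v ∈ Z → IsSafe G v) → Σ (Subset n) (λ S → IsStrongStable G S × Z ⊆ S)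
  strong-stable-set-containing innocent Z consistent safe with any? (_∈? Z)
  ... | no Z-empty with strong-stable-set (proj₁ (proj₂ innocent))
  ...   | S , strong = S , strong , λ z∈Z → ⊥-elim (Z-empty (_ , z∈Z))
  strong-stable-set-containing innocent Z consistent safe | yes (a , a∈Z)
    with any? (λ b → b ∈? Z ×-dec ¬? (side a ≟ᵇ side b))
  ... | yes (b , b∈Z , sides) =
    ⁅ a ⁆ ∪ ⁅ b ⁆ ,
    strong-bisimplicial (even-pair-bisimplicial a∼b (consistent a b a∈Z b∈Z (∼⇒≢ a∼b))) ,
    consistent-⊆-pair consistent a∈Z b∈Z sides
    where
    a∼b : a ∼ b
    a∼b = consistent-∼ consistent a∈Z b∈Z sides
  ... | no one-side with strong-through (safe-bisimplicial (safe a a∈Z))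
  ...   | S , strong , a∈S = S , strong , Z⊆S
    where
    Z⊆S : Z ⊆ S
    Z⊆S {z} z∈Z with side a ≟ᵇ side z
    ... | yes same = subst (_∈ S) (consistent-one-per-side consistent a∈Z z∈Z same) a∈S
    ... | no sides = ⊥-elim (one-side (z , z∈Z , sides))

lemma3p15 : (G : Graph) (A : Subset (Graph.n G)) →
    IsCobipartite G A → Innocent G →
    (Z : Subset (Graph.n G)) → IsConsistent G Z →
    (∀ v → v ∈ Z → IsSafe G v) →
    Σ (Subset (Graph.n G)) (λ S → IsStrongStable G S × Z ⊆ S)
lemma3p15 G A cobipartite = Cobipartite.strong-stable-set-containing G A cobipartite
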